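{- Let $n\ge 2$ and $\pi\in\mathcal{D}^1_{2n}(2413,3142)$, written in the block form $\cdots A_i B_i A_{i-1} B_{i-1}\cdots A_1 B_0 (2k) A_0 (2k-1)$ described in the context, and let $\rho$ be the map described in the context. \begin{enumerate} \item If $\pi$ is of the form $(2n) A_0 (2n-1)$, then $\rho(\pi)$ is a primitive Dyck path with no marked down-steps at level 0 or 1. \item If the first non-empty block (from the left) of $\pi$ is $B_i$, then $\rho(\pi)$ is not primitive. \item If the first non-empty block of $\pi$ is $A_i$ for some $i\ge 1$, then $\rho(\pi)$ is a primitive Dyck path with at least one marked down-step at level 1. Moreover: -- if $\rho(\pi)$ has exactly one marked down-step at level 1, then $\pi$ is of the form $A_1 (2n) A_0 (2n-1)$; -- if $\rho(\pi)$ has at least two marked down-steps at level 1, then $B_{i-1}$ is not empty. \end{enumerate}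
   Context: A Dumont permutation of the first kind is a permutation $\pi\in\mathfrak{S}_{2n}$ such that each even entry is followed by a descent (and is not last) and each odd entry is followed by an ascent or is at the end. $\mathcal{D}^1_{2n}(2413,3142)$ denotes the set of such permutations of length $2n$ avoiding the patterns $2413$ and $3142$. A Dyck path of semi-length $n$ is a word in $U$ (up-step) and $D$ (down-step) with $n$ of each never going below the $x$-axis; it is primitive if it touches the $x$-axis only at its endpoints. A down-step is at level $h$ if its lower endpoint has height $h$ (ground level means level 0). Block decomposition: if $\pi\in\mathcal{D}^1_{2n}(2413,3142)$ ends with $2k-1$, then $\pi=\cdots A_i B_i A_{i-1}B_{i-1}\cdots A_1 B_0 (2k) A_0 (2k-1)$, where $A_0$ is the part between $2k$ and $2k-1$, every entry of each $A_i$ ($i\ge0$) is less than $2k-1$, every entry of each $B_i$ ($i\ge 0$) is greater than $2k$, the blocks $A_1,B_1,\dots$ are nonempty while $A_0,B_0$ may be empty. For a string $W$ of distinct integers, $\tau(W)$ is the permutation order-isomorphic to $W$; $c(\sigma)$ is the complement of a permutation $\sigma$ of length $m$ ($b_i=m+1-a_i$). The map $\rho$ from $\mathcal{D}^1_{2n}(2413,3142)$ to Dyck paths of semi-length $n$ with some marked down-steps not at ground level is defined recursively: $\rho(21)=UD$. For $n\ge2$: Case 1: if $\pi=(2n)A_0(2n-1)$, then $\rho(\pi)=U\rho(A_0)D$. Case 2: if the first nonempty block (from the left) is $B_i$, then $\rho(\pi)$ is the concatenation of $\rho(c(\tau(B_i)))$ and $\rho(\pi-B_i)$, where $\pi-B_i$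 is $\pi$ with $B_i$ removed. Case 3: if the first nonempty block is $A_i$ with $i\ge1$, then $\rho(\pi)=\rho(\tau(A_i))\sqcup\rho(\tau(\pi-A_i))$, where for marked Dyck paths $P_1,P_2$: (i) mark the last down-step of $P_1$ to get $\tilde P_1$; (ii) write the primitive decomposition $P_2=Q_1\cdots Q_j$; if $j\ge2$ mark the last down-step of $Q_{j-1}$ to get $\tilde Q_{j-1}$; (iii) writing $Q_j=UR_jD$, set $P_1\sqcup P_2=U\tilde P_1 Q_1\cdots Q_{j-2}\tilde Q_{j-1}R_jD$. -}

module Defs where

open import Data.Nat using (ℕ; zero; suc; _+_; _*_; _∸_; _<_; _≤_; _<ᵇ_; _≡ᵇ_)
open import Data.Nat.Properties using (_<?_)
open import Data.Bool using (Bool; true; false; if_then_else_; not; _∧_)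
open import Data.List using (List; []; _∷_; _++_; map; filter; length; reverse; drop; upTo; concat)
open import Data.List.Relation.Binary.Permutation.Propositional using (_↭_)
open import Data.List.Relation.Binary.Sublist.Propositional using (_⊆_)
open import Data.Maybe using (Maybe; just; nothing)
open import Data.Product using (_×_; _,_; ∃; proj₁; proj₂)
open import Data.Unit using (⊤)
open import Data.Empty using (⊥)
open import Relation.Nullary using (¬_)
open import Relation.Binary.PropositionalEquality using (_≡_; _≢_)

IsPerm : List ℕ → Set
IsPerm w = w ↭ map suc (upTo (length w))

isEven : ℕ → Bool
isEven zero = true
isEven (suc zero) = false
isEven (suc (suc n)) = isEven n

Dumont1 : List ℕ → Set
Dumont1 [] = ⊤
Dumont1 (x ∷ []) = isEven x ≡ false
Dumont1 (x ∷ y ∷ w) = (if isEven x then y < x else x < y) × Dumont1 (y ∷ w)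

rank : List ℕ → ℕ → ℕ
rank W x = suc (length (filter (_<? x) W))

τ : List ℕ → List ℕ
τ W = map (rank W) W

c : List ℕ → List ℕ
c σ = map (λ a → suc (length σ) ∸ a) σ

Contains : List ℕ → List ℕ → Set
Contains w p = ∃ λ s → (s ⊆ w) × (τ s ≡ p)

Avoids : List ℕ → List ℕ → Set
Avoids w p = ¬ Contains w p

InD1 : ℕ → List ℕ → Set
InD1 n π = (length π ≡ 2 * n) × IsPerm π × Dumont1 π
         × Avoids π (2 ∷ 4 ∷ 1 ∷ 3 ∷ []) × Avoids π (3 ∷ 1 ∷ 4 ∷ 2 ∷ [])

lastOr : List ℕ → ℕ
lastOr [] = 0
lastOr (x ∷ []) = x
lastOr (x ∷ y ∷ w) = lastOr (y ∷ w)

dropLast : List ℕ → List ℕ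
dropLast [] = []
dropLast (x ∷ []) = []
dropLast (x ∷ y ∷ w) = x ∷ dropLast (y ∷ w)

breakAt : ℕ → List ℕ → List ℕ × List ℕ
breakAt v [] = [] , []
breakAt v (y ∷ w) = if y ≡ᵇ v then ([] , w)
                    else (y ∷ proj₁ (breakAt v w) , proj₂ (breakAt v w))

-- the prefix of π before 2k (where 2k−1 is the last entry of π)
prefix2k : List ℕ → List ℕ
prefix2k π = proj₁ (breakAt (suc (lastOr π)) π)

A0 : List ℕ → List ℕ
A0 π = dropLast (proj₂ (breakAt (suc (lastOr π)) π))

-- an entry q ≠ 2k, 2k−1 is "large" (belongs to a B-block) iff q > 2k−1
isLarge : List ℕ → ℕ → Bool
isLarge π q = lastOr π <ᵇ q

sameB : Bool → Bool → Bool
sameB a b = if a then b else not b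

runs : (ℕ → Bool) → List ℕ → List (List ℕ)
runs f [] = []
runs f (y ∷ w) = ins (runs f w)
  where
  ins : List (List ℕ) → List (List ℕ)
  ins [] = (y ∷ []) ∷ []
  ins ([] ∷ rs) = (y ∷ []) ∷ rs
  ins ((z ∷ zs) ∷ rs) = if sameB (f y) (f z) then (y ∷ z ∷ zs) ∷ rs
                        else (y ∷ []) ∷ (z ∷ zs) ∷ rs

prefixBlocks : List ℕ → List (List ℕ)
prefixBlocks π = runs (isLarge π) (prefix2k π)

-- slots π = [B_0 , A_1 , B_1 , A_2 , B_2 , …] (read from 2k leftwards),
-- where B_0 may be empty; all other listed blocks are nonempty.
slots : List ℕ → List (List ℕ)
slots π with reverse (prefixBlocks π)
... | [] = []
... | [] ∷ rs = [] ∷ rs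
... | (q ∷ qs) ∷ rs = if isLarge π q then (q ∷ qs) ∷ rs else [] ∷ (q ∷ qs) ∷ rs

lookupOr : List (List ℕ) → ℕ → List ℕ
lookupOr [] _ = []
lookupOr (x ∷ xs) zero = x
lookupOr (x ∷ xs) (suc k) = lookupOr xs k

-- B_j  (empty if it does not occur)
Bblk : List ℕ → ℕ → List ℕ
Bblk π j = lookupOr (slots π) (2 * j)

-- A_i for i ≥ 1 (empty if it does not occur)
Ablk : List ℕ → ℕ → List ℕ
Ablk π i = lookupOr (slots π) (2 * i ∸ 1)

-- the first nonempty block from the left is B_i
FirstBlockIsB : List ℕ → ℕ → Set
FirstBlockIsB π i = length (slots π) ≡ suc (2 * i)

-- the first nonempty block from the left is A_i (i ≥ 1)
FirstBlockIsA : List ℕ → ℕ → Set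
FirstBlockIsA π i = length (slots π) ≡ 2 * i

data Step : Set where
  U : Step
  D : (marked : Bool) → Step

Path : Set
Path = List Step

DyckFrom : ℕ → Path → Set
DyckFrom h [] = h ≡ 0
DyckFrom h (U ∷ p) = DyckFrom (suc h) p
DyckFrom zero (D _ ∷ p) = ⊥
DyckFrom (suc h) (D _ ∷ p) = DyckFrom h p

IsDyck : Path → Set
IsDyck = DyckFrom 0

Primitive : Path → Set
Primitive p = IsDyck p × (p ≢ [])
            × (∀ q r → p ≡ q ++ r → q ≢ [] → r ≢ [] → ¬ IsDyck q)

-- number of marked down-steps at level l (level = height of lower endpoint)
markedAtFrom : ℕ → ℕ → Path → ℕ
markedAtFrom l h [] = 0
markedAtFrom l h (U ∷ p) = markedAtFrom l (suc h) p
markedAtFrom l h (D m ∷ p) =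
  (if m ∧ ((h ∸ 1) ≡ᵇ l) then 1 else 0) + markedAtFrom l (h ∸ 1) p

markedAt : ℕ → Path → ℕ
markedAt l = markedAtFrom l 0

markFirstD : Path → Path
markFirstD [] = []
markFirstD (U ∷ p) = U ∷ markFirstD p
markFirstD (D _ ∷ p) = D true ∷ p

markLast : Path → Path
markLast p = reverse (markFirstD (reverse p))

primsGo : ℕ → Path → Path → List Path
primsGo h [] [] = []
primsGo h (a ∷ acc) [] = reverse (a ∷ acc) ∷ []
primsGo h acc (U ∷ p) = primsGo (suc h) (U ∷ acc) p
primsGo zero acc (D m ∷ p) = primsGo zero (D m ∷ acc) p
primsGo (suc zero) acc (D m ∷ p) = reverse (D m ∷ acc) ∷ primsGo zero [] p
primsGo (suc (suc h)) acc (D m ∷ p) = primsGo (suc h) (D m ∷ acc) p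

prims : Path → List Path
prims = primsGo 0 []

splitLast : List Path → Maybe (List Path × Path)
splitLast [] = nothing
splitLast (x ∷ []) = just ([] , x)
splitLast (x ∷ y ∷ xs) with splitLast (y ∷ xs)
... | nothing = nothing
... | just (f , l) = just (x ∷ f , l)

-- P₁ ⊔ P₂ = U P̃₁ Q₁ ⋯ Q_{j−2} Q̃_{j−1} R_j D   where Q_j = U R_j D
-- (drop 1 Q_j = R_j D; marking the last down-step of Q₁⋯Q_{j−1} marks
--  that of Q_{j−1}, and does nothing when j = 1)
_⊔_ : Path → Path → Path
P₁ ⊔ P₂ with splitLast (prims P₂)
... | nothing = U ∷ (markLast P₁ ++ D false ∷ [])
... | just (front , Qj) = U ∷ (markLast P₁ ++ markLast (concat front) ++ drop 1 Qj)

firstBlock : List ℕ → List ℕ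
firstBlock π with prefixBlocks π
... | [] = []
... | r ∷ _ = r

ρ' : ℕ → List ℕ → Path
ρ' zero π = []
ρ' (suc f) [] = []
ρ' (suc f) π@(_ ∷ _) with firstBlock π
... | [] = U ∷ (ρ' f (A0 π) ++ D false ∷ [])                       -- Case 1 (includes ρ(21) = UD)
... | r@(q ∷ _) = if isLarge π q
                  then ρ' f (c (τ r)) ++ ρ' f (τ (drop (length r) π))
                  else ρ' f (τ r) ⊔ ρ' f (τ (drop (length r) π))

ρ : List ℕ → Path
ρ π = ρ' (length π) π

module Submission where

-- Every ρ(σ) is a Dyck path with no marked down-step at level 0, and
-- P₁ ⊔ P₂ = U P̃₁ Q₁ ⋯ Q̃_{j−1} R_j D is primitive by construction.  In Case 1,
-- ρ(π) = U ρ(A₀) D raises the marks of ρ(A₀), none of them at level 0, by one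
-- level.  In Case 2, ρ(π) is the concatenation of two nonempty Dyck paths.  In
-- Case 3 the level-1 marks of ρ(π) are exactly the marked last down-steps of P̃₁
-- and, when j ≥ 2, of Q̃_{j−1}; and j ≥ 2 exactly when π − A_i still begins with
-- a B-block, since otherwise it begins with its own 2k and so falls under Case 1.
-- If A_i is the only block, 2k is followed by a smaller entry (a Dumont descent),
-- so any entry 2n > 2k to its right would create a 3142; hence 2k = 2n.

open import Defs
open import Data.Nat using (ℕ; zero; suc; _+_; _≤_; _<_; _*_; _∸_; z≤n; s≤s; _<ᵇ_; _≡ᵇ_)
import Data.Nat.Properties as ℕP
open import Data.Bool using (Bool; true; false; if_then_else_; not; _∧_; T)
import Data.Bool.Properties as BoolP
open import Data.List using (List; []; _∷_; _++_; map; filter; length; reverse; drop; concat; initLast; _∷ʳ′_)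
import Data.List.Properties as ListP
open import Data.List.Relation.Unary.All using (All; []; _∷_)
import Data.List.Relation.Unary.All as All
import Data.List.Relation.Unary.All.Properties as AllP
open import Data.List.Membership.Propositional using (_∈_)
import Data.List.Membership.Propositional.Properties as ∈P
open import Data.List.Relation.Unary.Any using (here; there)
open import Data.List.Relation.Unary.Unique.Propositional using (Unique)
import Data.List.Relation.Unary.Unique.Propositional.Properties as UniqueP
open import Data.List.Relation.Unary.AllPairs using ([]; _∷_)
open import Data.List.Relation.Binary.Permutation.Propositional using (↭-sym; ↭⇒↭ₛ)
import Data.List.Relation.Binary.Permutation.Setoid.Properties as PermS
import Data.List.Relation.Binary.Permutation.Propositional.Properties as PermP
import Data.List.Relation.Binary.Sublist.Propositional as Sublist
import Data.List.Relation.Binary.Sublist.Propositional.Properties as SublistP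
open import Data.Maybe using (just; nothing)
open import Data.Product using (_×_; _,_; ∃; ∃₂; proj₁; proj₂)
open import Data.Sum using (_⊎_; inj₁; inj₂)
open import Data.Empty using (⊥; ⊥-elim)
open import Data.Unit using (⊤; tt)
open import Relation.Nullary using (¬_; yes; no; contradiction)
open import Relation.Binary.PropositionalEquality

≡ᵇ-refl : ∀ a → (a ≡ᵇ a) ≡ true
≡ᵇ-refl zero = refl
≡ᵇ-refl (suc a) = ≡ᵇ-refl a

≡ᵇ≡true⇒≡ : ∀ a b → (a ≡ᵇ b) ≡ true → a ≡ b
≡ᵇ≡true⇒≡ a b e = ℕP.≡ᵇ⇒≡ a b (subst T (sym e) tt)

≢⇒≡ᵇ≡false : ∀ a b → a ≢ b → (a ≡ᵇ b) ≡ false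
≢⇒≡ᵇ≡false a b a≢b with a ≡ᵇ b in eq
... | false = refl
... | true = contradiction (≡ᵇ≡true⇒≡ a b eq) a≢b

≡ᵇ-+ʳ : ∀ a b h → (a + h ≡ᵇ b + h) ≡ (a ≡ᵇ b)
≡ᵇ-+ʳ a b zero rewrite ℕP.+-identityʳ a | ℕP.+-identityʳ b = refl
≡ᵇ-+ʳ a b (suc h) rewrite ℕP.+-suc a h | ℕP.+-suc b h = ≡ᵇ-+ʳ a b h

<ᵇ≡true⇒< : ∀ a b → (a <ᵇ b) ≡ true → a < b
<ᵇ≡true⇒< a b e = ℕP.<ᵇ⇒< a b (subst T (sym e) tt)

<ᵇ≡false⇒≮ : ∀ a b → (a <ᵇ b) ≡ false → ¬ a < b
<ᵇ≡false⇒≮ a b e a<b = subst T e (ℕP.<⇒<ᵇ a<b)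

<⇒<ᵇ≡true : ∀ a b → a < b → (a <ᵇ b) ≡ true
<⇒<ᵇ≡true a b a<b with a <ᵇ b in eq
... | true = refl
... | false = contradiction a<b (<ᵇ≡false⇒≮ a b eq)

≮⇒<ᵇ≡false : ∀ a b → ¬ a < b → (a <ᵇ b) ≡ false
≮⇒<ᵇ≡false a b a≮b with a <ᵇ b in eq
... | false = refl
... | true = contradiction (<ᵇ≡true⇒< a b eq) a≮b

<ᵇ-irrefl : ∀ a → (a <ᵇ a) ≡ false
<ᵇ-irrefl a = ≮⇒<ᵇ≡false a a (ℕP.<-irrefl refl)

-- Dyck paths

heightAfter : ℕ → Path → ℕ
heightAfter h [] = h
heightAfter h (U ∷ p) = heightAfter (suc h) p
heightAfter h (D _ ∷ p) = heightAfter (h ∸ 1) p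

dyckFrom-++ : ∀ h A B → DyckFrom h A → IsDyck B → DyckFrom h (A ++ B)
dyckFrom-++ h [] B refl dB = dB
dyckFrom-++ h (U ∷ A) B dA dB = dyckFrom-++ (suc h) A B dA dB
dyckFrom-++ (suc h) (D _ ∷ A) B dA dB = dyckFrom-++ h A B dA dB

dyckFrom-++⁻ʳ : ∀ h A B → DyckFrom h (A ++ B) → DyckFrom (heightAfter h A) B
dyckFrom-++⁻ʳ h [] B d = d
dyckFrom-++⁻ʳ h (U ∷ A) B d = dyckFrom-++⁻ʳ (suc h) A B d
dyckFrom-++⁻ʳ (suc h) (D _ ∷ A) B d = dyckFrom-++⁻ʳ h A B d

dyckFrom⇒heightAfter≡0 : ∀ h A → DyckFrom h A → heightAfter h A ≡ 0
dyckFrom⇒heightAfter≡0 h [] d = d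
dyckFrom⇒heightAfter≡0 h (U ∷ A) d = dyckFrom⇒heightAfter≡0 (suc h) A d
dyckFrom⇒heightAfter≡0 (suc h) (D _ ∷ A) d = dyckFrom⇒heightAfter≡0 h A d

heightAfter-+ : ∀ h k A → DyckFrom k A → heightAfter (k + h) A ≡ h
heightAfter-+ h k [] refl = refl
heightAfter-+ h k (U ∷ A) d = heightAfter-+ h (suc k) A d
heightAfter-+ h (suc k) (D _ ∷ A) d = heightAfter-+ h k A d

markedAtFrom-++ : ∀ l h A B →
  markedAtFrom l h (A ++ B) ≡ markedAtFrom l h A + markedAtFrom l (heightAfter h A) B
markedAtFrom-++ l h [] B = refl
markedAtFrom-++ l h (U ∷ A) B = markedAtFrom-++ l (suc h) A B
markedAtFrom-++ l h (D m ∷ A) B rewrite markedAtFrom-++ l (h ∸ 1) A B =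
  sym (ℕP.+-assoc (if m ∧ ((h ∸ 1) ≡ᵇ l) then 1 else 0) _ _)

markedAtFrom-lift : ∀ l h k A → DyckFrom k A → markedAtFrom (l + h) (k + h) A ≡ markedAtFrom l k A
markedAtFrom-lift l h k [] d = refl
markedAtFrom-lift l h k (U ∷ A) d = markedAtFrom-lift l h (suc k) A d
markedAtFrom-lift l h (suc k) (D m ∷ A) d rewrite ≡ᵇ-+ʳ k l h | markedAtFrom-lift l h k A d = refl

markedAtFrom-below : ∀ l h k A → DyckFrom k A → l < h → markedAtFrom l (k + h) A ≡ 0
markedAtFrom-below l h k [] d l<h = refl
markedAtFrom-below l h k (U ∷ A) d l<h = markedAtFrom-below l h (suc k) A d l<h
markedAtFrom-below l h (suc k) (D m ∷ A) d l<h
  rewrite ≢⇒≡ᵇ≡false (k + h) l (λ e → ℕP.<-irrefl (sym e) (ℕP.<-≤-trans l<h (ℕP.m≤n+m h k)))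
        | BoolP.∧-zeroʳ m = markedAtFrom-below l h k A d l<h

markedAt₁-lifted-++ : ∀ A R → IsDyck A →
  markedAtFrom 1 1 (A ++ R) ≡ markedAt 0 A + markedAtFrom 1 1 R
markedAt₁-lifted-++ A R d
  rewrite markedAtFrom-++ 1 1 A R | heightAfter-+ 1 0 A d | markedAtFrom-lift 0 1 0 A d = refl

markedAt₀-lifted-++ : ∀ A R → IsDyck A → markedAtFrom 0 1 (A ++ R) ≡ markedAtFrom 0 1 R
markedAt₀-lifted-++ A R d
  rewrite markedAtFrom-++ 0 1 A R | heightAfter-+ 1 0 A d | markedAtFrom-below 0 1 0 A d (s≤s z≤n) = refl

markedAt₀-++ : ∀ A R → IsDyck A → markedAt 0 (A ++ R) ≡ markedAt 0 A + markedAt 0 R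
markedAt₀-++ A R d rewrite markedAtFrom-++ 0 0 A R | dyckFrom⇒heightAfter≡0 0 A d = refl

GroundOnlyAtEnd : ℕ → Path → Set
GroundOnlyAtEnd h [] = ⊥
GroundOnlyAtEnd h (U ∷ p) = GroundOnlyAtEnd (suc h) p
GroundOnlyAtEnd zero (D _ ∷ p) = ⊥
GroundOnlyAtEnd (suc zero) (D _ ∷ []) = ⊤
GroundOnlyAtEnd (suc zero) (D _ ∷ _ ∷ _) = ⊥
GroundOnlyAtEnd (suc (suc h)) (D _ ∷ p) = GroundOnlyAtEnd (suc h) p

groundOnlyAtEnd⇒dyckFrom : ∀ h p → GroundOnlyAtEnd h p → DyckFrom h p
groundOnlyAtEnd⇒dyckFrom h (U ∷ p) g = groundOnlyAtEnd⇒dyckFrom (suc h) p g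
groundOnlyAtEnd⇒dyckFrom (suc zero) (D _ ∷ []) g = refl
groundOnlyAtEnd⇒dyckFrom (suc (suc h)) (D _ ∷ p) g = groundOnlyAtEnd⇒dyckFrom (suc h) p g

groundOnlyAtEnd-dyck-++ : ∀ h k X t → DyckFrom k X → GroundOnlyAtEnd (suc h) t →
  GroundOnlyAtEnd (k + suc h) (X ++ t)
groundOnlyAtEnd-dyck-++ h k [] t refl g = g
groundOnlyAtEnd-dyck-++ h k (U ∷ X) t d g = groundOnlyAtEnd-dyck-++ h (suc k) X t d g
groundOnlyAtEnd-dyck-++ h (suc k) (D m ∷ X) t d g
  rewrite ℕP.+-suc k h =
    subst (λ j → GroundOnlyAtEnd j (X ++ t)) (ℕP.+-suc k h) (groundOnlyAtEnd-dyck-++ h k X t d g)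

groundOnlyAtEnd-dyck-prefix : ∀ h q r → GroundOnlyAtEnd (suc h) (q ++ r) → DyckFrom (suc h) q → r ≡ []
groundOnlyAtEnd-dyck-prefix h (U ∷ q) r g d = groundOnlyAtEnd-dyck-prefix (suc h) q r g d
groundOnlyAtEnd-dyck-prefix zero (D m ∷ q) r g d with q ++ r in eq
... | [] = ListP.++-conicalʳ q r eq
groundOnlyAtEnd-dyck-prefix (suc h) (D m ∷ q) r g d = groundOnlyAtEnd-dyck-prefix h q r g d

PrimitiveForm : Path → Set
PrimitiveForm Q = ∃ λ t → Q ≡ U ∷ t × GroundOnlyAtEnd 1 t

primitiveForm⇒isDyck : ∀ Q → PrimitiveForm Q → IsDyck Q
primitiveForm⇒isDyck Q (t , refl , g) = groundOnlyAtEnd⇒dyckFrom 1 t g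

groundOnlyAtEnd⇒primitive : ∀ t → GroundOnlyAtEnd 1 t → Primitive (U ∷ t)
groundOnlyAtEnd⇒primitive t g = groundOnlyAtEnd⇒dyckFrom 1 t g , (λ ()) , indecomposable
  where
  indecomposable : ∀ q r → U ∷ t ≡ q ++ r → q ≢ [] → r ≢ [] → ¬ IsDyck q
  indecomposable [] r eq q≢[] r≢[] d = q≢[] refl
  indecomposable (U ∷ q) r refl q≢[] r≢[] d = r≢[] (groundOnlyAtEnd-dyck-prefix 0 q r g d)

primitive-indecomposable : ∀ P → Primitive P → ∀ A B → P ≡ A ++ B → A ≢ [] → B ≢ [] → ¬ IsDyck A
primitive-indecomposable P (_ , _ , indecomposable) = indecomposable

MarkedDyck : Path → Set
MarkedDyck P = IsDyck P × markedAt 0 P ≡ 0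

raise : Path → Path
raise X = U ∷ (X ++ D false ∷ [])

raise-groundOnlyAtEnd : ∀ X → IsDyck X → GroundOnlyAtEnd 1 (X ++ D false ∷ [])
raise-groundOnlyAtEnd X d = groundOnlyAtEnd-dyck-++ 0 0 X (D false ∷ []) d tt

raise-primitive : ∀ X → IsDyck X → Primitive (raise X)
raise-primitive X d = groundOnlyAtEnd⇒primitive (X ++ D false ∷ []) (raise-groundOnlyAtEnd X d)

raise-markedDyck : ∀ X → IsDyck X → MarkedDyck (raise X)
raise-markedDyck X d = groundOnlyAtEnd⇒dyckFrom 1 (X ++ D false ∷ []) (raise-groundOnlyAtEnd X d) ,
                       markedAt₀-lifted-++ X (D false ∷ []) d

raise-markedAt₁ : ∀ X → IsDyck X → markedAt 1 (raise X) ≡ markedAt 0 X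
raise-markedAt₁ X d = trans (markedAt₁-lifted-++ X (D false ∷ []) d) (ℕP.+-identityʳ _)

eraseStep : Step → Step
eraseStep U = U
eraseStep (D _) = D false

eraseMarks : Path → Path
eraseMarks = map eraseStep

dyckFrom-resp-eraseMarks : ∀ h p q → eraseMarks p ≡ eraseMarks q → DyckFrom h p → DyckFrom h q
dyckFrom-resp-eraseMarks h [] [] e d = d
dyckFrom-resp-eraseMarks h (U ∷ p) (U ∷ q) e d =
  dyckFrom-resp-eraseMarks (suc h) p q (ListP.∷-injectiveʳ e) d
dyckFrom-resp-eraseMarks (suc h) (D _ ∷ p) (D _ ∷ q) e d =
  dyckFrom-resp-eraseMarks h p q (ListP.∷-injectiveʳ e) d
dyckFrom-resp-eraseMarks h (U ∷ p) (D _ ∷ q) () d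
dyckFrom-resp-eraseMarks (suc h) (D _ ∷ p) (U ∷ q) () d

eraseMarks-markFirstD : ∀ p → eraseMarks (markFirstD p) ≡ eraseMarks p
eraseMarks-markFirstD [] = refl
eraseMarks-markFirstD (U ∷ p) = cong (U ∷_) (eraseMarks-markFirstD p)
eraseMarks-markFirstD (D _ ∷ p) = refl

eraseMarks-markLast : ∀ p → eraseMarks (markLast p) ≡ eraseMarks p
eraseMarks-markLast p = begin
  map eraseStep (reverse (markFirstD (reverse p)))  ≡⟨ ListP.reverse-map eraseStep (markFirstD (reverse p)) ⟩
  reverse (eraseMarks (markFirstD (reverse p)))     ≡⟨ cong reverse (eraseMarks-markFirstD (reverse p)) ⟩
  reverse (map eraseStep (reverse p))               ≡⟨ cong reverse (ListP.reverse-map eraseStep p) ⟩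
  reverse (reverse (eraseMarks p))                  ≡⟨ ListP.reverse-involutive (eraseMarks p) ⟩
  eraseMarks p                                      ∎
  where open ≡-Reasoning

dyckFrom-markLast : ∀ h p → DyckFrom h p → DyckFrom h (markLast p)
dyckFrom-markLast h p = dyckFrom-resp-eraseMarks h p (markLast p) (sym (eraseMarks-markLast p))

markLast-∷ʳ : ∀ P m → markLast (P ++ D m ∷ []) ≡ P ++ D true ∷ []
markLast-∷ʳ P m rewrite ListP.reverse-++ P (D m ∷ []) =
  trans (ListP.unfold-reverse (D true) (reverse P)) (cong (_++ D true ∷ []) (ListP.reverse-involutive P))

dyck-endsWithD : ∀ P → IsDyck P → P ≢ [] →
  ∃₂ λ P′ m → P ≡ P′ ++ D m ∷ [] × heightAfter 0 P′ ≡ 1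
dyck-endsWithD P d P≢[] with initLast P
... | [] = contradiction refl P≢[]
... | P′ ∷ʳ′ U with dyckFrom-++⁻ʳ 0 P′ (U ∷ []) d
...   | ()
dyck-endsWithD P d P≢[] | P′ ∷ʳ′ D m =
  P′ , m , refl , lastStepFrom1 (heightAfter 0 P′) (dyckFrom-++⁻ʳ 0 P′ (D m ∷ []) d)
  where
  lastStepFrom1 : ∀ e → DyckFrom e (D m ∷ []) → e ≡ 1
  lastStepFrom1 (suc zero) _ = refl

markedAt₀-markLast-pos : ∀ P → IsDyck P → P ≢ [] → 1 ≤ markedAt 0 (markLast P)
markedAt₀-markLast-pos P d P≢[] with dyck-endsWithD P d P≢[]
... | P′ , m , refl , e
  rewrite markLast-∷ʳ P′ m | markedAtFrom-++ 0 0 P′ (D true ∷ []) | e =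
  ℕP.m≤n+m 1 (markedAt 0 P′)

markedAt₀-markLast-unmarked : ∀ P → IsDyck P → P ≢ [] → markedAt 0 P ≡ 0 → markedAt 0 (markLast P) ≡ 1
markedAt₀-markLast-unmarked P d P≢[] z with dyck-endsWithD P d P≢[]
... | P′ , m , refl , e
  rewrite markLast-∷ʳ P′ m | markedAtFrom-++ 0 0 P′ (D true ∷ []) | markedAtFrom-++ 0 0 P′ (D m ∷ []) | e =
  cong (_+ 1) (ℕP.m+n≡0⇒m≡0 (markedAt 0 P′) z)

-- The primitive decomposition

primsGo-U : ∀ h acc p → primsGo h acc (U ∷ p) ≡ primsGo (suc h) (U ∷ acc) p
primsGo-U h [] p = refl
primsGo-U h (x ∷ acc) p = refl

primsGo-D₁ : ∀ acc m p → primsGo 1 acc (D m ∷ p) ≡ reverse (D m ∷ acc) ∷ primsGo 0 [] p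
primsGo-D₁ [] m p = refl
primsGo-D₁ (x ∷ acc) m p = refl

primsGo-D₂ : ∀ h acc m p → primsGo (suc (suc h)) acc (D m ∷ p) ≡ primsGo (suc h) (D m ∷ acc) p
primsGo-D₂ h [] m p = refl
primsGo-D₂ h (x ∷ acc) m p = refl

reverse-∷-++ : ∀ (x : Step) acc s → reverse (x ∷ acc) ++ s ≡ reverse acc ++ x ∷ s
reverse-∷-++ x acc s rewrite ListP.unfold-reverse x acc = ListP.++-assoc (reverse acc) (x ∷ []) s

-- The accumulator acc holds, reversed, the part of the current primitive
-- factor read so far; the invariant says it can be completed to one.
mutual
  prims-correct : ∀ p → IsDyck p → concat (prims p) ≡ p × All PrimitiveForm (prims p)
  prims-correct [] d = refl , []
  prims-correct (U ∷ p) d = primsGo-correct 0 (U ∷ []) p d (λ s g → s , refl , g)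

  primsGo-correct : ∀ h acc p → DyckFrom (suc h) p →
    (∀ s → GroundOnlyAtEnd (suc h) s → PrimitiveForm (reverse acc ++ s)) →
    concat (primsGo (suc h) acc p) ≡ reverse acc ++ p × All PrimitiveForm (primsGo (suc h) acc p)
  primsGo-correct h acc (U ∷ p) d inv rewrite primsGo-U (suc h) acc p
    with primsGo-correct (suc h) (U ∷ acc) p d
           (λ s g → subst PrimitiveForm (sym (reverse-∷-++ U acc s)) (inv (U ∷ s) g))
  ... | c , a = trans c (reverse-∷-++ U acc p) , a
  primsGo-correct zero acc (D m ∷ p) d inv rewrite primsGo-D₁ acc m p with prims-correct p d
  ... | c , a =
    trans (cong (reverse (D m ∷ acc) ++_) c) (reverse-∷-++ (D m) acc p) ,
    subst PrimitiveForm (trans (sym (reverse-∷-++ (D m) acc [])) (ListP.++-identityʳ _)) (inv (D m ∷ []) tt) ∷ a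
  primsGo-correct (suc h) acc (D m ∷ p) d inv rewrite primsGo-D₂ h acc m p
    with primsGo-correct h (D m ∷ acc) p d
           (λ s g → subst PrimitiveForm (sym (reverse-∷-++ (D m) acc s)) (inv (D m ∷ s) g))
  ... | c , a = trans c (reverse-∷-++ (D m) acc p) , a

concat-primitiveForms-isDyck : ∀ Qs → All PrimitiveForm Qs → IsDyck (concat Qs)
concat-primitiveForms-isDyck [] [] = refl
concat-primitiveForms-isDyck (Q ∷ Qs) (q ∷ qs) =
  dyckFrom-++ 0 Q (concat Qs) (primitiveForm⇒isDyck Q q) (concat-primitiveForms-isDyck Qs qs)

splitLast-view : ∀ (Qs : List Path) → (Qs ≡ [] × splitLast Qs ≡ nothing) ⊎
  (∃₂ λ front Q → Qs ≡ front ++ Q ∷ [] × splitLast Qs ≡ just (front , Q))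
splitLast-view [] = inj₁ (refl , refl)
splitLast-view (Q ∷ []) = inj₂ ([] , Q , refl , refl)
splitLast-view (Q ∷ Q′ ∷ Qs) with splitLast-view (Q′ ∷ Qs)
... | inj₁ (() , _)
... | inj₂ (front , Q″ , eq , s) rewrite s = inj₂ (Q ∷ front , Q″ , cong (Q ∷_) eq , refl)

splitLast-nothing : ∀ Qs → splitLast Qs ≡ nothing → Qs ≡ []
splitLast-nothing Qs e with splitLast-view Qs
... | inj₁ (Qs≡[] , _) = Qs≡[]
... | inj₂ (_ , _ , _ , s) with trans (sym e) s
... | ()

splitLast-just : ∀ Qs front Q → splitLast Qs ≡ just (front , Q) → Qs ≡ front ++ Q ∷ []
splitLast-just Qs front Q e with splitLast-view Qs
... | inj₁ (_ , s) with trans (sym e) s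
... | ()
splitLast-just Qs front Q e | inj₂ (_ , _ , eq , s) with trans (sym e) s
... | refl = eq

-- The operation ⊔

-- M = Q₁ ⋯ Q_{j−1} and U t = Q_j (M = [] and t = D when P₂ is empty).
⊔-shape : ∀ P₁ P₂ → IsDyck P₂ → ∃₂ λ M t →
  (P₁ ⊔ P₂ ≡ U ∷ (markLast P₁ ++ markLast M ++ t)) × IsDyck M × GroundOnlyAtEnd 1 t ×
  ((P₂ ≡ [] × M ≡ [] × t ≡ D false ∷ []) ⊎ P₂ ≡ M ++ U ∷ t)
⊔-shape P₁ P₂ d with splitLast (prims P₂) in eq
... | nothing = [] , D false ∷ [] , refl , refl , tt ,
      inj₁ (trans (sym (proj₁ (prims-correct P₂ d))) (cong concat (splitLast-nothing (prims P₂) eq)) , refl , refl)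
... | just (front , Qj) with prims-correct P₂ d | splitLast-just (prims P₂) front Qj eq
... | c , a | e rewrite e with AllP.++⁻ front a
... | af , (t , refl , g) ∷ [] =
  concat front , t , refl , concat-primitiveForms-isDyck front af , g ,
  inj₂ (trans (sym c) (trans (sym (ListP.concat-++ front ((U ∷ t) ∷ [])))
         (cong (concat front ++_) (ListP.++-identityʳ (U ∷ t)))))

⊔-primitive : ∀ P₁ P₂ → IsDyck P₁ → IsDyck P₂ → Primitive (P₁ ⊔ P₂)
⊔-primitive P₁ P₂ d₁ d₂ with ⊔-shape P₁ P₂ d₂
... | M , t , eq , dM , g , _ rewrite eq =
  groundOnlyAtEnd⇒primitive (markLast P₁ ++ markLast M ++ t)
    (groundOnlyAtEnd-dyck-++ 0 0 (markLast P₁) _ (dyckFrom-markLast 0 P₁ d₁)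
      (groundOnlyAtEnd-dyck-++ 0 0 (markLast M) t (dyckFrom-markLast 0 M dM) g))

⊔-markedAt₀ : ∀ P₁ P₂ → IsDyck P₁ → IsDyck P₂ → markedAt 0 P₂ ≡ 0 → markedAt 0 (P₁ ⊔ P₂) ≡ 0
⊔-markedAt₀ P₁ P₂ d₁ d₂ z with ⊔-shape P₁ P₂ d₂
... | M , t , eq , dM , g , shape rewrite eq
  | markedAt₀-lifted-++ (markLast P₁) (markLast M ++ t) (dyckFrom-markLast 0 P₁ d₁)
  | markedAt₀-lifted-++ (markLast M) t (dyckFrom-markLast 0 M dM) = lastFactor shape
  where
  lastFactor : (P₂ ≡ [] × M ≡ [] × t ≡ D false ∷ []) ⊎ P₂ ≡ M ++ U ∷ t → markedAtFrom 0 1 t ≡ 0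
  lastFactor (inj₁ (_ , _ , refl)) = refl
  lastFactor (inj₂ refl) = ℕP.m+n≡0⇒n≡0 (markedAt 0 M)
    (trans (sym (trans (markedAtFrom-++ 0 0 M (U ∷ t))
      (cong (λ h → markedAt 0 M + markedAtFrom 0 h (U ∷ t)) (dyckFrom⇒heightAfter≡0 0 M dM)))) z)

⊔-nonempty : ∀ P₁ P₂ → P₁ ⊔ P₂ ≢ []
⊔-nonempty P₁ P₂ with splitLast (prims P₂)
... | nothing = λ ()
... | just _ = λ ()

-- A marked down-step at level 0 of P̃₁ or Q̃_{j−1} lies at level 1 in P₁ ⊔ P₂.
⊔-markedAt₁ : ∀ P₁ P₂ M t → IsDyck P₁ → IsDyck M →
  P₁ ⊔ P₂ ≡ U ∷ (markLast P₁ ++ markLast M ++ t) →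
  markedAt 1 (P₁ ⊔ P₂) ≡ markedAt 0 (markLast P₁) + (markedAt 0 (markLast M) + markedAtFrom 1 1 t)
⊔-markedAt₁ P₁ P₂ M t d₁ dM eq rewrite eq
  | markedAt₁-lifted-++ (markLast P₁) (markLast M ++ t) (dyckFrom-markLast 0 P₁ d₁)
  | markedAt₁-lifted-++ (markLast M) t (dyckFrom-markLast 0 M dM) = refl

⊔-markedAt₁-pos : ∀ P₁ P₂ → IsDyck P₁ → P₁ ≢ [] → IsDyck P₂ → 1 ≤ markedAt 1 (P₁ ⊔ P₂)
⊔-markedAt₁-pos P₁ P₂ d₁ P₁≢[] d₂ with ⊔-shape P₁ P₂ d₂
... | M , t , eq , dM , _ rewrite ⊔-markedAt₁ P₁ P₂ M t d₁ dM eq =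
  ℕP.≤-trans (markedAt₀-markLast-pos P₁ d₁ P₁≢[]) (ℕP.m≤m+n _ _)

⊔-markedAt₁-decomposable : ∀ P₁ P₂ → IsDyck P₁ → P₁ ≢ [] → IsDyck P₂ →
  (∃₂ λ A B → P₂ ≡ A ++ B × A ≢ [] × B ≢ [] × IsDyck A) → 2 ≤ markedAt 1 (P₁ ⊔ P₂)
⊔-markedAt₁-decomposable P₁ P₂ d₁ P₁≢[] d₂ (A , B , refl , A≢[] , B≢[] , dA) with ⊔-shape P₁ P₂ d₂
... | M , t , eq , dM , g , inj₁ (P₂≡[] , _) = ⊥-elim (A≢[] (ListP.++-conicalˡ A B P₂≡[]))
... | M , t , eq , dM , g , inj₂ P₂≡MUt rewrite ⊔-markedAt₁ P₁ P₂ M t d₁ dM eq with M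
...   | [] = ⊥-elim (primitive-indecomposable (U ∷ t) (groundOnlyAtEnd⇒primitive t g) A B (sym P₂≡MUt) A≢[] B≢[] dA)
...   | Q ∷ M′ = ℕP.≤-trans
          (ℕP.+-mono-≤ (markedAt₀-markLast-pos P₁ d₁ P₁≢[]) (markedAt₀-markLast-pos (Q ∷ M′) dM (λ ())))
          (ℕP.+-monoʳ-≤ (markedAt 0 (markLast P₁)) (ℕP.m≤m+n _ _))

⊔-markedAt₁-primitive : ∀ P₁ X → IsDyck P₁ → P₁ ≢ [] → markedAt 0 P₁ ≡ 0 → IsDyck X → markedAt 0 X ≡ 0 →
  markedAt 1 (P₁ ⊔ raise X) ≡ 1
⊔-markedAt₁-primitive P₁ X d₁ P₁≢[] z₁ dX zX with raise-groundOnlyAtEnd X dX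
... | g with ⊔-shape P₁ (raise X) (proj₁ (raise-markedDyck X dX))
... | M , t , eq , dM , _ , inj₁ (() , _)
... | M , t , eq , dM , _ , inj₂ P₂≡MUt with M
...   | Q ∷ M′ = ⊥-elim (primitive-indecomposable _ (groundOnlyAtEnd⇒primitive (X ++ D false ∷ []) g)
                   (Q ∷ M′) (U ∷ t) P₂≡MUt (λ ()) (λ ()) dM)
...   | [] with P₂≡MUt
...     | refl = trans (⊔-markedAt₁ P₁ (U ∷ t) [] t d₁ dM eq)
                  (cong₂ _+_ (markedAt₀-markLast-unmarked P₁ d₁ P₁≢[] z₁)
                    (trans (markedAt₁-lifted-++ X (D false ∷ []) dX) (cong (_+ 0) zX)))

-- Blocks

isEven-suc : ∀ k → isEven (suc k) ≡ not (isEven k)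
isEven-suc zero = refl
isEven-suc (suc zero) = refl
isEven-suc (suc (suc k)) = isEven-suc k

isEven-2* : ∀ i → isEven (2 * i) ≡ true
isEven-2* zero = refl
isEven-2* (suc i) rewrite ℕP.+-suc i (i + 0) = isEven-2* i

notIterate : ℕ → Bool → Bool
notIterate zero b = b
notIterate (suc k) b = notIterate k (not b)

notIterate-isEven : ∀ k b → notIterate k b ≡ (if isEven k then b else not b)
notIterate-isEven zero b = refl
notIterate-isEven (suc zero) b = refl
notIterate-isEven (suc (suc k)) b rewrite notIterate-isEven k (not (not b)) | BoolP.not-involutive b = refl

sameB-true : ∀ a b → sameB a b ≡ true → a ≡ b
sameB-true true true _ = refl
sameB-true false false _ = refl

sameB-false : ∀ a b → sameB a b ≡ false → a ≢ b
sameB-false true false _ ()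
sameB-false false true _ ()

insertRun : (ℕ → Bool) → ℕ → List (List ℕ) → List (List ℕ)
insertRun f y [] = (y ∷ []) ∷ []
insertRun f y ([] ∷ rs) = (y ∷ []) ∷ rs
insertRun f y ((z ∷ zs) ∷ rs) = if sameB (f y) (f z) then (y ∷ z ∷ zs) ∷ rs
                                else (y ∷ []) ∷ (z ∷ zs) ∷ rs

runs-∷ : ∀ f y w → runs f (y ∷ w) ≡ insertRun f y (runs f w)
runs-∷ f y w with runs f w
... | [] = refl
... | [] ∷ rs = refl
... | (z ∷ zs) ∷ rs = refl

insertRun-same : ∀ f y z zs rs → sameB (f y) (f z) ≡ true → insertRun f y ((z ∷ zs) ∷ rs) ≡ (y ∷ z ∷ zs) ∷ rs
insertRun-same f y z zs rs e rewrite e = refl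

insertRun-new : ∀ f y z zs rs → sameB (f y) (f z) ≡ false →
  insertRun f y ((z ∷ zs) ∷ rs) ≡ (y ∷ []) ∷ (z ∷ zs) ∷ rs
insertRun-new f y z zs rs e rewrite e = refl

FirstRun : (ℕ → Bool) → ℕ → List ℕ → Set
FirstRun f y w = ∃₂ λ r s → runs f (y ∷ w) ≡ (y ∷ r) ∷ runs f s × y ∷ w ≡ (y ∷ r) ++ s
  × All (λ z → f z ≡ f y) r × (s ≡ [] ⊎ ∃₂ λ b s′ → s ≡ b ∷ s′ × f b ≢ f y)

firstRun : ∀ f y w → FirstRun f y w
firstRun f y [] = [] , [] , refl , refl , [] , inj₁ refl
firstRun f y (z ∷ w) with firstRun f z w
... | r , s , eq , w≡ , same , next with sameB (f y) (f z) in sb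
... | true = z ∷ r , s ,
      trans (runs-∷ f y (z ∷ w)) (trans (cong (insertRun f y) eq) (insertRun-same f y z r (runs f s) sb)) ,
      cong (y ∷_) w≡ , sym fy≡fz ∷ All.map (λ e → trans e (sym fy≡fz)) same , nextClass next
  where
  fy≡fz = sameB-true (f y) (f z) sb
  nextClass : (s ≡ [] ⊎ ∃₂ λ b s′ → s ≡ b ∷ s′ × f b ≢ f z) → (s ≡ [] ⊎ ∃₂ λ b s′ → s ≡ b ∷ s′ × f b ≢ f y)
  nextClass (inj₁ s≡[]) = inj₁ s≡[]
  nextClass (inj₂ (b , s′ , s≡ , fb≢fz)) = inj₂ (b , s′ , s≡ , λ e → fb≢fz (trans e fy≡fz))
... | false = [] , z ∷ w ,
      trans (runs-∷ f y (z ∷ w)) (trans (cong (insertRun f y) eq) (trans (insertRun-new f y z r (runs f s) sb) (cong ((y ∷ []) ∷_) (sym eq)))) ,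
      refl , [] , inj₂ (z , w , refl , λ e → sameB-false (f y) (f z) sb (sym e))

runs-≡[] : ∀ f s → runs f s ≡ [] → s ≡ []
runs-≡[] f [] e = refl
runs-≡[] f (z ∷ s) e with firstRun f z s
... | r , s′ , eq , _ with trans (sym e) eq
... | ()

Alternating : (ℕ → Bool) → List (List ℕ) → Bool → Set
Alternating f [] b = ⊤
Alternating f ([] ∷ B) b = ⊥
Alternating f ((q ∷ qs) ∷ B) b = f q ≡ b × Alternating f B (not b)

alternating-runs : ∀ f y w → Alternating f (runs f (y ∷ w)) (f y)
alternating-runs f y [] = refl , tt
alternating-runs f y (z ∷ w) with firstRun f z w | alternating-runs f z w
... | r , s , eq , _ | alt rewrite runs-∷ f y (z ∷ w) | eq with sameB (f y) (f z) in sb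
... | true rewrite sameB-true (f y) (f z) sb = refl , proj₂ alt
... | false with BoolP.¬-not (λ e → sameB-false (f y) (f z) sb (sym e))
... | fz≡¬fy = refl , fz≡¬fy , subst (Alternating f (runs f s)) (cong not fz≡¬fy) (proj₂ alt)

alternating-nonempty : ∀ f B b → Alternating f B b → All (λ x → x ≢ []) B
alternating-nonempty f [] b alt = []
alternating-nonempty f ((q ∷ qs) ∷ B) b (_ , alt) = (λ ()) ∷ alternating-nonempty f B (not b) alt

alternating-last : ∀ f B L b → Alternating f (B ++ L ∷ []) b →
  ∃₂ λ q qs → L ≡ q ∷ qs × f q ≡ notIterate (length B) b
alternating-last f [] (q ∷ qs) b (e , _) = q , qs , refl , e
alternating-last f ((x ∷ xs) ∷ B) L b (_ , alt) = alternating-last f B L (not b) alt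

slotsOf : (ℕ → Bool) → List (List ℕ) → List (List ℕ)
slotsOf f [] = []
slotsOf f ([] ∷ rs) = [] ∷ rs
slotsOf f ((q ∷ qs) ∷ rs) = if f q then (q ∷ qs) ∷ rs else [] ∷ (q ∷ qs) ∷ rs

slots≡slotsOf : ∀ π → slots π ≡ slotsOf (isLarge π) (reverse (prefixBlocks π))
slots≡slotsOf π with reverse (prefixBlocks π)
... | [] = refl
... | [] ∷ rs = refl
... | (q ∷ qs) ∷ rs = refl

SlotsShape : (ℕ → Bool) → List (List ℕ) → Bool → Set
SlotsShape f B b = ∃₂ λ B′ q → ∃ λ qs → B ≡ B′ ++ (q ∷ qs) ∷ [] × f q ≡ notIterate (length B′) b ×
  slotsOf f (reverse B) ≡ (if f q then (q ∷ qs) ∷ reverse B′ else [] ∷ (q ∷ qs) ∷ reverse B′)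

slotsShape : ∀ f B b → Alternating f B b → B ≢ [] → SlotsShape f B b
slotsShape f B b alt B≢[] with initLast B
... | [] = contradiction refl B≢[]
... | B′ ∷ʳ′ L with alternating-last f B′ L b alt
... | q , qs , refl , e rewrite ListP.reverse-++ B′ ((q ∷ qs) ∷ []) = B′ , q , qs , refl , e , refl

length-if : ∀ (c : Bool) (x : List ℕ) (y z : List (List ℕ)) →
  length (if c then x ∷ y else z) ≡ (if c then suc (length y) else length z)
length-if true x y z = refl
length-if false x y z = refl

slotsOf-length-parity : ∀ f B b → Alternating f B b → B ≢ [] →
  isEven (length (slotsOf f (reverse B))) ≡ not b
slotsOf-length-parity f B b alt B≢[] with slotsShape f B b alt B≢[]
... | B′ , q , qs , refl , e , s≡
  rewrite s≡ | length-if (f q) (q ∷ qs) (reverse B′) ([] ∷ (q ∷ qs) ∷ reverse B′)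
        | ListP.length-reverse B′ | notIterate-isEven (length B′) b with f q
... | true rewrite isEven-suc (length B′) with isEven (length B′)
...   | true = cong not e
...   | false = e
slotsOf-length-parity f B b alt B≢[] | B′ , q , qs , refl , e , s≡ | false with isEven (length B′)
...   | true = cong not e
...   | false = e

lookupOr-nonempty : ∀ (xs : List (List ℕ)) k → All (λ x → x ≢ []) xs → k < length xs → lookupOr xs k ≢ []
lookupOr-nonempty (x ∷ xs) zero (p ∷ ps) lt = p
lookupOr-nonempty (x ∷ xs) (suc k) (p ∷ ps) (s≤s lt) = lookupOr-nonempty xs k ps lt

2*-<-2*suc : ∀ j → 2 * j < 2 * suc j
2*-<-2*suc j rewrite ℕP.+-suc j (j + 0) = ℕP.n≤1+n _

-- Only with a single block A₁ before 2k can the slot B_{i−1} be empty.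
slotsOf-B-empty : ∀ (S : List (List ℕ)) (L : List ℕ) (X : List (List ℕ)) (c : Bool) j →
  S ≡ (if c then L ∷ X else [] ∷ L ∷ X) → L ≢ [] → All (λ x → x ≢ []) X → length S ≡ 2 * suc j →
  lookupOr S (2 * j) ≡ [] → X ≡ []
slotsOf-B-empty S L X true j refl L≢[] X≢[] len e =
  contradiction e (lookupOr-nonempty (L ∷ X) (2 * j) (L≢[] ∷ X≢[]) (subst (2 * j <_) (sym len) (2*-<-2*suc j)))
slotsOf-B-empty S L [] false zero refl L≢[] X≢[] len e = refl
slotsOf-B-empty S L (_ ∷ X) false zero refl L≢[] X≢[] () e
slotsOf-B-empty S L X false (suc j) refl L≢[] X≢[] len e =
  contradiction e (lookupOr-nonempty (L ∷ X) (j + suc (j + 0)) (L≢[] ∷ X≢[])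
    (ℕP.≤-pred (subst (2 * suc j <_) (sym len) (2*-<-2*suc (suc j)))))

breakAt-prefix : ∀ v xs → ∃ λ t → xs ≡ proj₁ (breakAt v xs) ++ t
breakAt-prefix v [] = [] , refl
breakAt-prefix v (y ∷ w) with y ≡ᵇ v
... | true = y ∷ w , refl
... | false with breakAt-prefix v w
... | t , e = t , cong (y ∷_) e

breakAt-∈ : ∀ v xs → v ∈ xs → xs ≡ proj₁ (breakAt v xs) ++ v ∷ proj₂ (breakAt v xs)
breakAt-∈ v (y ∷ w) v∈ with y ≡ᵇ v in e
... | true = cong (_∷ w) (≡ᵇ≡true⇒≡ y v e)
breakAt-∈ v (y ∷ w) (here refl) | false = contradiction (trans (sym (≡ᵇ-refl v)) e) (λ ())
breakAt-∈ v (y ∷ w) (there v∈) | false = cong (y ∷_) (breakAt-∈ v w v∈)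

breakAt-∉ : ∀ v xs → All (_≢ v) (proj₁ (breakAt v xs))
breakAt-∉ v [] = []
breakAt-∉ v (y ∷ w) with y ≡ᵇ v in e
... | true = []
... | false = (λ { refl → contradiction (trans (sym (≡ᵇ-refl v)) e) (λ ()) }) ∷ breakAt-∉ v w

breakAt-head-≡ : ∀ v a l → a ≡ v → proj₁ (breakAt v (a ∷ l)) ≡ []
breakAt-head-≡ v a l refl rewrite ≡ᵇ-refl v = refl

breakAt-head-≢ : ∀ v a l → a ≢ v → proj₁ (breakAt v (a ∷ l)) ≡ a ∷ proj₁ (breakAt v l)
breakAt-head-≢ v a l a≢v rewrite ≢⇒≡ᵇ≡false a v a≢v = refl

headOr : List (List ℕ) → List ℕ
headOr [] = []
headOr (r ∷ _) = r

firstBlock≡headOr : ∀ π → firstBlock π ≡ headOr (prefixBlocks π)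
firstBlock≡headOr π with prefixBlocks π
... | [] = refl
... | r ∷ _ = refl

record FirstBlockView (π : List ℕ) : Set where
  field
    y : ℕ
    r s : List ℕ
    prefix≡ : prefix2k π ≡ (y ∷ r) ++ s
    blocks≡ : prefixBlocks π ≡ (y ∷ r) ∷ runs (isLarge π) s
    firstBlock≡ : firstBlock π ≡ y ∷ r
    sameClass : All (λ z → isLarge π z ≡ isLarge π y) r
    nextBlock : s ≡ [] ⊎ ∃₂ λ b s′ → s ≡ b ∷ s′ × isLarge π b ≢ isLarge π y
    alternating : Alternating (isLarge π) (prefixBlocks π) (isLarge π y)

  blocks≢[] : prefixBlocks π ≢ []
  blocks≢[] e with trans (sym blocks≡) e
  ... | ()

firstBlockView : ∀ π → prefix2k π ≡ [] ⊎ FirstBlockView π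
firstBlockView π = view (prefix2k π) refl
  where
  view : ∀ w → prefix2k π ≡ w → prefix2k π ≡ [] ⊎ FirstBlockView π
  view [] e = inj₁ e
  view (y ∷ w) e with firstRun (isLarge π) y w
  ... | r , s , eq , w≡ , same , next = inj₂ (record
    { y = y ; r = r ; s = s
    ; prefix≡ = trans e w≡
    ; blocks≡ = blocks≡
    ; firstBlock≡ = trans (firstBlock≡headOr π) (cong headOr blocks≡)
    ; sameClass = same
    ; nextBlock = next
    ; alternating = subst (λ B → Alternating (isLarge π) B (isLarge π y))
                      (sym (cong (runs (isLarge π)) e)) (alternating-runs (isLarge π) y w)
    })
    where
    blocks≡ : prefixBlocks π ≡ (y ∷ r) ∷ runs (isLarge π) s
    blocks≡ = trans (cong (runs (isLarge π)) e) eq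

prefix2k≡[]⇒firstBlock≡[] : ∀ π → prefix2k π ≡ [] → firstBlock π ≡ []
prefix2k≡[]⇒firstBlock≡[] π e = trans (firstBlock≡headOr π) (cong (λ w → headOr (runs (isLarge π) w)) e)

prefix2k≡[]⇒slots≡[] : ∀ π → prefix2k π ≡ [] → slots π ≡ []
prefix2k≡[]⇒slots≡[] π e =
  trans (slots≡slotsOf π) (cong (λ w → slotsOf (isLarge π) (reverse (runs (isLarge π) w))) e)

module _ {π : List ℕ} (V : FirstBlockView π) where
  open FirstBlockView V

  slots-length-parity : isEven (length (slots π)) ≡ not (isLarge π y)
  slots-length-parity = trans (cong (λ S → isEven (length S)) (slots≡slotsOf π))
    (slotsOf-length-parity (isLarge π) (prefixBlocks π) (isLarge π y) alternating blocks≢[])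

  firstBlockIsB⇒large : ∀ i → FirstBlockIsB π i → isLarge π y ≡ true
  firstBlockIsB⇒large i len = trans (sym (BoolP.not-involutive _))
    (cong not (trans (sym slots-length-parity)
      (trans (cong isEven len) (trans (isEven-suc (2 * i)) (cong not (isEven-2* i))))))

  firstBlockIsA⇒small : ∀ i → FirstBlockIsA π i → isLarge π y ≡ false
  firstBlockIsA⇒small i len = trans (sym (BoolP.not-involutive _))
    (cong not (trans (sym slots-length-parity) (trans (cong isEven len) (isEven-2* i))))

  Bblk≡[]⇒single-block : ∀ j → FirstBlockIsA π (suc j) → Bblk π j ≡ [] → s ≡ []
  Bblk≡[]⇒single-block j len B≡[]
    with slotsShape (isLarge π) (prefixBlocks π) (isLarge π y) alternating blocks≢[]
  ... | B′ , q , qs , blocks≡B′L , _ , slots≡ with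
    slotsOf-B-empty (slots π) (q ∷ qs) (reverse B′) (isLarge π q) j (trans (slots≡slotsOf π) slots≡) (λ ())
      (PermP.All-resp-↭ (↭-sym (PermP.↭-reverse B′)) (AllP.++⁻ˡ B′ (subst (All (_≢ [])) blocks≡B′L
        (alternating-nonempty _ _ _ alternating)))) len B≡[]
  ... | revB′≡[] = runs-≡[] (isLarge π) s (ListP.∷-injectiveʳ (trans (sym blocks≡)
                     (trans blocks≡B′L (cong (_++ (q ∷ qs) ∷ []) B′≡[]))))
    where
    B′≡[] : B′ ≡ []
    B′≡[] = ListP.reverse-injective revB′≡[]

firstBlock-prefix : ∀ π q qs → firstBlock π ≡ q ∷ qs →
  ∃ λ rest → π ≡ (q ∷ qs) ++ rest × All (λ z → isLarge π z ≡ isLarge π q) (q ∷ qs)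
firstBlock-prefix π q qs e with firstBlockView π
... | inj₁ e′ with trans (sym e) (prefix2k≡[]⇒firstBlock≡[] π e′)
...   | ()
firstBlock-prefix π q qs e | inj₂ V with trans (sym e) (FirstBlockView.firstBlock≡ V)
... | refl with breakAt-prefix (suc (lastOr π)) π
... | t , π≡ = s ++ t , trans π≡ (trans (cong (_++ t) prefix≡) (ListP.++-assoc (q ∷ qs) s t)) , refl ∷ sameClass
  where open FirstBlockView V

lastOr-All : ∀ (P : ℕ → Set) y r → All P (y ∷ r) → P (lastOr (y ∷ r))
lastOr-All P y [] (p ∷ []) = p
lastOr-All P y (z ∷ r) (p ∷ ps) = lastOr-All P z r ps

-- Because the last entry 2k − 1 is never large.
firstBlock-large-proper : ∀ π q qs → firstBlock π ≡ q ∷ qs → isLarge π q ≡ true →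
  ∃ λ rest → π ≡ (q ∷ qs) ++ rest × rest ≢ []
firstBlock-large-proper π q qs e q-large with firstBlock-prefix π q qs e
... | rest , π≡ , same = rest , π≡ , rest≢[]
  where
  rest≢[] : rest ≢ []
  rest≢[] refl = contradiction
    (subst (λ v → isLarge π v ≡ true) (sym (cong lastOr (trans π≡ (ListP.++-identityʳ (q ∷ qs)))))
      (lastOr-All (λ z → isLarge π z ≡ true) q qs (All.map (λ e → trans e q-large) same)))
    (λ e → contradiction (trans (sym (<ᵇ-irrefl (lastOr π))) e) (λ ()))

length-++-< : ∀ (π r rest : List ℕ) → π ≡ r ++ rest → rest ≢ [] → length r < length π
length-++-< π r [] e rest≢[] = contradiction refl rest≢[]
length-++-< π r (x ∷ rest) refl _ rewrite ListP.length-++ r {x ∷ rest} | ℕP.+-suc (length r) (length rest) =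
  s≤s (ℕP.m≤m+n (length r) (length rest))

length-τ : ∀ r → length (τ r) ≡ length r
length-τ r = ListP.length-map _ r

length-c-τ : ∀ r → length (c (τ r)) ≡ length r
length-c-τ r = trans (ListP.length-map _ (τ r)) (length-τ r)

τ-nonempty : ∀ w → w ≢ [] → τ w ≢ []
τ-nonempty [] w≢[] = contradiction refl w≢[]
τ-nonempty (_ ∷ _) _ = λ ()

drop-length-++ : ∀ (r rest : List ℕ) → drop (length r) (r ++ rest) ≡ rest
drop-length-++ [] rest = refl
drop-length-++ (x ∷ r) rest = drop-length-++ r rest

Unique-++⁻ʳ : ∀ (A B : List ℕ) → Unique (A ++ B) → Unique B
Unique-++⁻ʳ A B u = subst Unique (drop-length-++ A B) (UniqueP.drop⁺ (length A) u)

-- The map ρ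

ρ'-step : ℕ → List ℕ → List ℕ → Path
ρ'-step f π [] = raise (ρ' f (A0 π))
ρ'-step f π r@(q ∷ _) = if isLarge π q
                        then ρ' f (c (τ r)) ++ ρ' f (τ (drop (length r) π))
                        else ρ' f (τ r) ⊔ ρ' f (τ (drop (length r) π))

ρ'-unfold : ∀ f x xs → ρ' (suc f) (x ∷ xs) ≡ ρ'-step f (x ∷ xs) (firstBlock (x ∷ xs))
ρ'-unfold f x xs with firstBlock (x ∷ xs)
... | [] = refl
... | q ∷ qs = refl

ρ'-firstBlock-[] : ∀ f x xs → firstBlock (x ∷ xs) ≡ [] →
  ρ' (suc f) (x ∷ xs) ≡ raise (ρ' f (A0 (x ∷ xs)))
ρ'-firstBlock-[] f x xs e rewrite ρ'-unfold f x xs | e = refl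

ρ'-firstBlock-large : ∀ f x xs q qs → firstBlock (x ∷ xs) ≡ q ∷ qs → isLarge (x ∷ xs) q ≡ true →
  ρ' (suc f) (x ∷ xs) ≡ ρ' f (c (τ (q ∷ qs))) ++ ρ' f (τ (drop (length (q ∷ qs)) (x ∷ xs)))
ρ'-firstBlock-large f x xs q qs e q-large rewrite ρ'-unfold f x xs | e | q-large = refl

ρ'-firstBlock-small : ∀ f x xs q qs → firstBlock (x ∷ xs) ≡ q ∷ qs → isLarge (x ∷ xs) q ≡ false →
  ρ' (suc f) (x ∷ xs) ≡ ρ' f (τ (q ∷ qs)) ⊔ ρ' f (τ (drop (length (q ∷ qs)) (x ∷ xs)))
ρ'-firstBlock-small f x xs q qs e q-small rewrite ρ'-unfold f x xs | e | q-small = refl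

ρ'-markedDyck : ∀ f π → MarkedDyck (ρ' f π)
ρ'-markedDyck zero π = refl , refl
ρ'-markedDyck (suc f) [] = refl , refl
ρ'-markedDyck (suc f) (x ∷ xs) with firstBlock (x ∷ xs)
... | [] = raise-markedDyck (ρ' f (A0 (x ∷ xs))) (proj₁ (ρ'-markedDyck f (A0 (x ∷ xs))))
... | r@(q ∷ qs) with isLarge (x ∷ xs) q
...   | true = dyckFrom-++ 0 P₁ P₂ d₁ d₂ , trans (markedAt₀-++ P₁ P₂ d₁) (cong₂ _+_ z₁ z₂)
  where
  P₁ = ρ' f (c (τ r))
  P₂ = ρ' f (τ (drop (length r) (x ∷ xs)))
  d₁ = proj₁ (ρ'-markedDyck f (c (τ r)))
  z₁ = proj₂ (ρ'-markedDyck f (c (τ r)))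
  d₂ = proj₁ (ρ'-markedDyck f (τ (drop (length r) (x ∷ xs))))
  z₂ = proj₂ (ρ'-markedDyck f (τ (drop (length r) (x ∷ xs))))
...   | false = proj₁ (⊔-primitive P₁ P₂ d₁ d₂) , ⊔-markedAt₀ P₁ P₂ d₁ d₂ z₂
  where
  P₁ = ρ' f (τ r)
  P₂ = ρ' f (τ (drop (length r) (x ∷ xs)))
  d₁ = proj₁ (ρ'-markedDyck f (τ r))
  d₂ = proj₁ (ρ'-markedDyck f (τ (drop (length r) (x ∷ xs))))
  z₂ = proj₂ (ρ'-markedDyck f (τ (drop (length r) (x ∷ xs))))

ρ'-isDyck : ∀ f π → IsDyck (ρ' f π)
ρ'-isDyck f π = proj₁ (ρ'-markedDyck f π)

ρ'-nonempty : ∀ f π → π ≢ [] → length π ≤ f → ρ' f π ≢ []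
ρ'-nonempty zero [] π≢[] _ = contradiction refl π≢[]
ρ'-nonempty (suc f) [] π≢[] _ = contradiction refl π≢[]
ρ'-nonempty (suc f) (x ∷ xs) π≢[] len with firstBlock (x ∷ xs) in e
... | [] = λ ()
... | q ∷ qs with isLarge (x ∷ xs) q in q-large
...   | false = ⊔-nonempty (ρ' f (τ (q ∷ qs))) (ρ' f (τ (drop (length (q ∷ qs)) (x ∷ xs))))
...   | true with firstBlock-large-proper (x ∷ xs) q qs e q-large
...     | rest , π≡ , rest≢[] =
  λ e′ → ρ'-nonempty f (c (τ (q ∷ qs))) (λ ()) block-fits (ListP.++-conicalˡ _ _ e′)
  where
  block-fits : length (c (τ (q ∷ qs))) ≤ f
  block-fits rewrite length-c-τ (q ∷ qs) = ℕP.≤-pred (ℕP.≤-trans (length-++-< _ _ _ π≡ rest≢[]) len)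

Decomposable : Path → Set
Decomposable P = ∃₂ λ A B → P ≡ A ++ B × A ≢ [] × B ≢ [] × IsDyck A

decomposable⇒¬primitive : ∀ P → Decomposable P → ¬ Primitive P
decomposable⇒¬primitive P (A , B , e , A≢[] , B≢[] , dA) prim =
  primitive-indecomposable P prim A B e A≢[] B≢[] dA

ρ'-firstBlock-large-decomposable : ∀ f x xs q qs → length (x ∷ xs) ≤ suc f →
  firstBlock (x ∷ xs) ≡ q ∷ qs → isLarge (x ∷ xs) q ≡ true → Decomposable (ρ' (suc f) (x ∷ xs))
ρ'-firstBlock-large-decomposable f x xs q qs len e q-large with firstBlock-large-proper (x ∷ xs) q qs e q-large
... | rest , π≡ , rest≢[] =
  ρ' f (c (τ (q ∷ qs))) , ρ' f (τ (drop (length (q ∷ qs)) (x ∷ xs))) ,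
  ρ'-firstBlock-large f x xs q qs e q-large ,
  ρ'-nonempty f _ (λ ()) block-fits , ρ'-nonempty f _ rest≢[]′ rest-fits , ρ'-isDyck f _
  where
  drop≡ : drop (length (q ∷ qs)) (x ∷ xs) ≡ rest
  drop≡ = trans (cong (drop (length (q ∷ qs))) π≡) (drop-length-++ (q ∷ qs) rest)
  block-fits : length (c (τ (q ∷ qs))) ≤ f
  block-fits rewrite length-c-τ (q ∷ qs) = ℕP.≤-pred (ℕP.≤-trans (length-++-< _ _ _ π≡ rest≢[]) len)
  rest≢[]′ : τ (drop (length (q ∷ qs)) (x ∷ xs)) ≢ []
  rest≢[]′ = τ-nonempty _ (λ e′ → rest≢[] (trans (sym drop≡) e′))
  rest-fits : length (τ (drop (length (q ∷ qs)) (x ∷ xs))) ≤ f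
  rest-fits rewrite length-τ (drop (length (q ∷ qs)) (x ∷ xs)) | ListP.length-drop (length (q ∷ qs)) (x ∷ xs) =
    ℕP.≤-pred (ℕP.≤-trans (s≤s (ℕP.m∸n≤m (length xs) (length qs))) len)

-- Permutations and ranks

countBelow : ℕ → List ℕ → ℕ
countBelow a w = length (filter (ℕP._<? a) w)

countBelow-∷-< : ∀ y a w → y < a → countBelow a (y ∷ w) ≡ suc (countBelow a w)
countBelow-∷-< y a w y<a rewrite <⇒<ᵇ≡true y a y<a = refl

countBelow-∷-≮ : ∀ y a w → ¬ y < a → countBelow a (y ∷ w) ≡ countBelow a w
countBelow-∷-≮ y a w y≮a rewrite ≮⇒<ᵇ≡false y a y≮a = refl

countBelow-mono : ∀ a z w → a ≤ z → countBelow a w ≤ countBelow z w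
countBelow-mono a z [] a≤z = z≤n
countBelow-mono a z (y ∷ w) a≤z with y <ᵇ a in e₁ | y <ᵇ z in e₂
... | true | true = s≤s (countBelow-mono a z w a≤z)
... | false | false = countBelow-mono a z w a≤z
... | false | true = ℕP.m≤n⇒m≤1+n (countBelow-mono a z w a≤z)
... | true | false = contradiction (ℕP.<-≤-trans (<ᵇ≡true⇒< y a e₁) a≤z) (<ᵇ≡false⇒≮ y z e₂)

countBelow-strictMono : ∀ a z w → a ∈ w → a < z → suc (countBelow a w) ≤ countBelow z w
countBelow-strictMono a z (y ∷ w) (here refl) a<z rewrite <ᵇ-irrefl a | <⇒<ᵇ≡true a z a<z =
  s≤s (countBelow-mono a z w (ℕP.<⇒≤ a<z))
countBelow-strictMono a z (y ∷ w) (there a∈) a<z with y <ᵇ a in e₁ | y <ᵇ z in e₂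
... | true | true = s≤s (countBelow-strictMono a z w a∈ a<z)
... | false | false = countBelow-strictMono a z w a∈ a<z
... | false | true = ℕP.m≤n⇒m≤1+n (countBelow-strictMono a z w a∈ a<z)
... | true | false = contradiction (ℕP.<-trans (<ᵇ≡true⇒< y a e₁) a<z) (<ᵇ≡false⇒≮ y z e₂)

<ᵇ-suc : ∀ y a → y ≢ a → (y <ᵇ suc a) ≡ (y <ᵇ a)
<ᵇ-suc y a y≢a with y <ᵇ a in e
... | true = <⇒<ᵇ≡true y (suc a) (ℕP.m<n⇒m<1+n (<ᵇ≡true⇒< y a e))
... | false = ≮⇒<ᵇ≡false y (suc a) λ y<1+a → <ᵇ≡false⇒≮ y a e (ℕP.≤∧≢⇒< (ℕP.≤-pred y<1+a) y≢a)

countBelow-suc-∉ : ∀ a w → All (_≢ a) w → countBelow (suc a) w ≡ countBelow a w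
countBelow-suc-∉ a [] [] = refl
countBelow-suc-∉ a (y ∷ w) (y≢a ∷ w≢a) rewrite <ᵇ-suc y a y≢a with y <ᵇ a
... | true = cong suc (countBelow-suc-∉ a w w≢a)
... | false = countBelow-suc-∉ a w w≢a

countBelow-suc-∈ : ∀ a w → Unique w → a ∈ w → countBelow (suc a) w ≡ suc (countBelow a w)
countBelow-suc-∈ a (y ∷ w) (y∉w ∷ u) (here refl) rewrite <ᵇ-irrefl a | <⇒<ᵇ≡true a (suc a) (ℕP.n<1+n a) =
  cong suc (countBelow-suc-∉ a w (All.map (λ a≢z z≡a → a≢z (sym z≡a)) y∉w))
countBelow-suc-∈ a (y ∷ w) (y∉w ∷ u) (there a∈) rewrite <ᵇ-suc y a (All.lookup y∉w a∈) with y <ᵇ a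
... | true = cong suc (countBelow-suc-∈ a w u a∈)
... | false = countBelow-suc-∈ a w u a∈

rank-suc : ∀ x₀ w → Unique w → x₀ ∈ w → rank w (suc x₀) ≡ suc (rank w x₀)
rank-suc x₀ w u x₀∈ = cong suc (countBelow-suc-∈ x₀ w u x₀∈)

rank-<-suc : ∀ x₀ b w → Unique w → x₀ ∈ w → suc x₀ ∈ w → suc x₀ < b → suc (suc (rank w x₀)) ≤ rank w b
rank-<-suc x₀ b w u x₀∈ v∈ v<b =
  s≤s (subst (_≤ countBelow b w) (cong suc (countBelow-suc-∈ x₀ w u x₀∈)) (countBelow-strictMono (suc x₀) b w v∈ v<b))

τ-3142 : ∀ a b c d → b < d → d < a → a < c → τ (a ∷ b ∷ c ∷ d ∷ []) ≡ 3 ∷ 1 ∷ 4 ∷ 2 ∷ []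
τ-3142 a b c d b<d d<a a<c =
  cong₂ _∷_ (cong suc rank-a) (cong₂ _∷_ (cong suc rank-b) (cong₂ _∷_ (cong suc rank-c) (cong (λ k → suc k ∷ []) rank-d)))
  where
  W = a ∷ b ∷ c ∷ d ∷ []
  b<a = ℕP.<-trans b<d d<a
  b<c = ℕP.<-trans b<a a<c
  d<c = ℕP.<-trans d<a a<c
  irr : ∀ x → ¬ x < x
  irr x = ℕP.<-irrefl refl
  rank-a : countBelow a W ≡ 2
  rank-a = trans (countBelow-∷-≮ a a _ (irr a)) (trans (countBelow-∷-< b a _ b<a)
    (cong suc (trans (countBelow-∷-≮ c a _ (ℕP.<-asym a<c)) (countBelow-∷-< d a [] d<a))))
  rank-b : countBelow b W ≡ 0
  rank-b = trans (countBelow-∷-≮ a b _ (ℕP.<-asym b<a)) (trans (countBelow-∷-≮ b b _ (irr b))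
    (trans (countBelow-∷-≮ c b _ (ℕP.<-asym b<c)) (countBelow-∷-≮ d b [] (ℕP.<-asym b<d))))
  rank-c : countBelow c W ≡ 3
  rank-c = trans (countBelow-∷-< a c _ a<c) (cong suc (trans (countBelow-∷-< b c _ b<c)
    (cong suc (trans (countBelow-∷-≮ c c _ (irr c)) (countBelow-∷-< d c [] d<c)))))
  rank-d : countBelow d W ≡ 1
  rank-d = trans (countBelow-∷-≮ a d _ (ℕP.<-asym d<a)) (trans (countBelow-∷-< b d _ b<d)
    (cong suc (trans (countBelow-∷-≮ c d _ (ℕP.<-asym d<c)) (countBelow-∷-≮ d d [] (irr d)))))

lastOr-∈ : ∀ z zs → lastOr (z ∷ zs) ∈ (z ∷ zs)
lastOr-∈ z [] = here refl
lastOr-∈ z (y ∷ zs) = there (lastOr-∈ y zs)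

lastOr-++ : ∀ xs y ys → lastOr (xs ++ y ∷ ys) ≡ lastOr (y ∷ ys)
lastOr-++ [] y ys = refl
lastOr-++ (x ∷ []) y ys = refl
lastOr-++ (x ∷ x′ ∷ xs) y ys = lastOr-++ (x′ ∷ xs) y ys

lastOr-map : ∀ (g : ℕ → ℕ) z zs → lastOr (map g (z ∷ zs)) ≡ g (lastOr (z ∷ zs))
lastOr-map g z [] = refl
lastOr-map g z (y ∷ zs) = lastOr-map g y zs

lastOr-∷ʳ : ∀ xs y → lastOr (xs ++ y ∷ []) ≡ y
lastOr-∷ʳ xs y = lastOr-++ xs y []

≡dropLast-∷ʳ-lastOr : ∀ z zs → z ∷ zs ≡ dropLast (z ∷ zs) ++ lastOr (z ∷ zs) ∷ []
≡dropLast-∷ʳ-lastOr z [] = refl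
≡dropLast-∷ʳ-lastOr z (y ∷ zs) = cong (z ∷_) (≡dropLast-∷ʳ-lastOr y zs)

perm-unique : ∀ π → IsPerm π → Unique π
perm-unique π p = PermS.Unique-resp-↭ (setoid ℕ) (↭⇒↭ₛ (↭-sym p)) (UniqueP.map⁺ ℕP.suc-injective (UniqueP.upTo⁺ (length π)))

perm-∈-bounds : ∀ π → IsPerm π → ∀ {z} → z ∈ π → 1 ≤ z × z ≤ length π
perm-∈-bounds π p z∈ with ∈P.∈-map⁻ suc (PermP.∈-resp-↭ p z∈)
... | k , k∈ , refl = s≤s z≤n , ∈P.∈-upTo⁻ k∈

perm-∋ : ∀ π → IsPerm π → ∀ k → k < length π → suc k ∈ π
perm-∋ π p k k<len = PermP.∈-resp-↭ (↭-sym p) (∈P.∈-map⁺ suc (∈P.∈-upTo⁺ k<len))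

dumont1-last-odd : ∀ z zs → Dumont1 (z ∷ zs) → isEven (lastOr (z ∷ zs)) ≡ false
dumont1-last-odd z [] d = d
dumont1-last-odd z (y ∷ zs) (_ , d) = dumont1-last-odd y zs d

dumont1-adjacent : ∀ xs a b ys → Dumont1 (xs ++ a ∷ b ∷ ys) → (if isEven a then b < a else a < b)
dumont1-adjacent [] a b ys d = proj₁ d
dumont1-adjacent (x ∷ []) a b ys d = proj₁ (proj₂ d)
dumont1-adjacent (x ∷ x′ ∷ xs) a b ys d = dumont1-adjacent (x′ ∷ xs) a b ys (proj₂ d)

-- Standardisation keeps 2k and 2k − 1 adjacent in value, so a word that
-- starts with 2k standardises to one falling under Case 1.
ρ'-τ-from-2k : ∀ f x₀ R → Unique (suc x₀ ∷ R) → lastOr (suc x₀ ∷ R) ≡ x₀ → length (suc x₀ ∷ R) ≤ f →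
  ∃ λ X → ρ' f (τ (suc x₀ ∷ R)) ≡ raise X × MarkedDyck X
ρ'-τ-from-2k (suc f) x₀ R u last≡ len =
  ρ' f (A0 (τ w)) , ρ'-firstBlock-[] f (g (suc x₀)) (map g R) (prefix2k≡[]⇒firstBlock≡[] (τ w) prefix≡[]) ,
  ρ'-markedDyck f (A0 (τ w))
  where
  w = suc x₀ ∷ R
  g = rank w
  prefix≡[] : prefix2k (τ w) ≡ []
  prefix≡[] = breakAt-head-≡ _ (g (suc x₀)) (map g R)
    (trans (rank-suc x₀ w u (subst (_∈ w) last≡ (lastOr-∈ (suc x₀) R)))
      (cong suc (sym (trans (lastOr-map g (suc x₀) R) (cong g last≡)))))

ρ'-τ-large-first-decomposable : ∀ f b ws x₀ → Unique (b ∷ ws) → suc x₀ ∈ (b ∷ ws) →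
  lastOr (b ∷ ws) ≡ x₀ → suc x₀ < b → length (b ∷ ws) ≤ f → Decomposable (ρ' f (τ (b ∷ ws)))
ρ'-τ-large-first-decomposable (suc f) b ws x₀ u v∈ last≡ v<b len = fromView (firstBlockView (τ w))
  where
  w = b ∷ ws
  g = rank w
  lastτ : lastOr (τ w) ≡ g x₀
  lastτ = trans (lastOr-map g b ws) (cong g last≡)
  gap : suc (suc (g x₀)) ≤ g b
  gap = rank-<-suc x₀ b w u (subst (_∈ w) last≡ (lastOr-∈ b ws)) v∈ v<b
  gb-large : isLarge (τ w) (g b) ≡ true
  gb-large = subst (λ k → (k <ᵇ g b) ≡ true) (sym lastτ) (<⇒<ᵇ≡true (g x₀) (g b) (ℕP.<-trans (ℕP.n<1+n (g x₀)) gap))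
  τ-prefix≡ : prefix2k (τ w) ≡ g b ∷ proj₁ (breakAt (suc (lastOr (τ w))) (map g ws))
  τ-prefix≡ = breakAt-head-≢ _ (g b) (map g ws) (λ e → ℕP.<-irrefl (sym (trans e (cong suc lastτ))) gap)
  fromView : prefix2k (τ w) ≡ [] ⊎ FirstBlockView (τ w) → Decomposable (ρ' (suc f) (τ w))
  fromView (inj₁ e) = contradiction (trans (sym e) τ-prefix≡) (λ ())
  fromView (inj₂ V) = ρ'-firstBlock-large-decomposable f (g b) (map g ws) (g b) r
    (subst (_≤ suc f) (sym (length-τ w)) len)
    (subst (λ k → firstBlock (τ w) ≡ k ∷ r) (ListP.∷-injectiveˡ (trans (sym prefix≡) τ-prefix≡)) firstBlock≡)
    gb-large
    where
    open FirstBlockView V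

-- 2k is even, so the entry z after it is smaller, hence z < 2k − 1; an entry
-- N > 2k further right, before the final 2k − 1, completes 2k z N (2k−1) ≈ 3142.
no-larger-after-2k : ∀ π A x₀ R N → π ≡ A ++ suc x₀ ∷ R → Unique π → Dumont1 π →
  Avoids π (3 ∷ 1 ∷ 4 ∷ 2 ∷ []) → isEven (suc x₀) ≡ true → lastOr π ≡ x₀ → suc x₀ < N → ¬ N ∈ R
no-larger-after-2k π A x₀ (z ∷ R) N refl u dum avoids even last≡ v<N (here refl) =
  ℕP.<-asym z<v v<N
  where
  z<v : z < suc x₀
  z<v = subst (λ b → if b then z < suc x₀ else suc x₀ < z) even (dumont1-adjacent A (suc x₀) z R dum)
no-larger-after-2k π A x₀ (z ∷ R) N refl u dum avoids even last≡ v<N (there N∈R)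
  with ∈P.∈-∃++ N∈R
... | R₁ , R₂ , refl = afterN R₂ refl
  where
  z<v : z < suc x₀
  z<v = subst (λ b → if b then z < suc x₀ else suc x₀ < z) even (dumont1-adjacent A (suc x₀) z (R₁ ++ N ∷ R₂) dum)
  π≡ : π ≡ (A ++ suc x₀ ∷ z ∷ R₁) ++ N ∷ R₂
  π≡ = sym (ListP.++-assoc A (suc x₀ ∷ z ∷ R₁) (N ∷ R₂))
  afterN : ∀ R₂′ → R₂′ ≡ R₂ → ⊥
  afterN [] refl = ℕP.<-irrefl (trans (sym last≡) (trans (cong lastOr π≡) (lastOr-∷ʳ (A ++ suc x₀ ∷ z ∷ R₁) N)))
                     (ℕP.<-trans (ℕP.n<1+n x₀) v<N)
  afterN (t ∷ R₃) refl = avoids (suc x₀ ∷ z ∷ N ∷ x₀ ∷ [] , pattern⊆π , τ-3142 (suc x₀) z N x₀ z<x₀ (ℕP.n<1+n x₀) v<N)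
    where
    x₀∈ : x₀ ∈ t ∷ R₃
    x₀∈ = subst (_∈ t ∷ R₃) (trans (sym (trans (cong lastOr π≡) (lastOr-++ (A ++ suc x₀ ∷ z ∷ R₁) N (t ∷ R₃)))) last≡)
            (lastOr-∈ t R₃)
    z<x₀ : z < x₀
    z<x₀ with Unique-++⁻ʳ A _ u
    ... | _ ∷ (z∉ ∷ _) = ℕP.≤∧≢⇒< (ℕP.≤-pred z<v) (All.lookup z∉ (∈P.∈-++⁺ʳ R₁ (there x₀∈)))
    pattern⊆π : (suc x₀ ∷ z ∷ N ∷ x₀ ∷ []) Sublist.⊆ π
    pattern⊆π = SublistP.++⁺ˡ A (refl Sublist.∷ (refl Sublist.∷ SublistP.++⁺ˡ R₁ (refl Sublist.∷ Sublist.from∈ x₀∈)))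

≡-around-2k : ∀ π A x₀ R → π ≡ A ++ suc x₀ ∷ R → lastOr π ≡ x₀ →
  π ≡ A ++ suc x₀ ∷ dropLast R ++ x₀ ∷ []
≡-around-2k π A x₀ [] π≡ last≡ =
  contradiction (trans (sym (trans (cong lastOr π≡) (lastOr-∷ʳ A (suc x₀)))) last≡) ℕP.1+n≢n
≡-around-2k π A x₀ (z ∷ R) π≡ last≡ = trans π≡ (cong (λ t → A ++ suc x₀ ∷ t)
  (trans (≡dropLast-∷ʳ-lastOr z R)
    (cong (λ k → dropLast (z ∷ R) ++ k ∷ []) (trans (sym (lastOr-++ A (suc x₀) (z ∷ R))) (trans (sym (cong lastOr π≡)) last≡)))))

-- The three cases

ρ-case₁ : ∀ N A → let π = suc N ∷ A ++ N ∷ [] in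
  Primitive (ρ π) × markedAt 0 (ρ π) ≡ 0 × markedAt 1 (ρ π) ≡ 0
ρ-case₁ N A = subst Primitive (sym ρ≡) (raise-primitive X dX) ,
              subst (λ P → markedAt 0 P ≡ 0) (sym ρ≡) (proj₂ (raise-markedDyck X dX)) ,
              trans (cong (markedAt 1) ρ≡) (trans (raise-markedAt₁ X dX) zX)
  where
  π = suc N ∷ A ++ N ∷ []
  X = ρ' (length (A ++ N ∷ [])) (A0 π)
  dX = proj₁ (ρ'-markedDyck (length (A ++ N ∷ [])) (A0 π))
  zX = proj₂ (ρ'-markedDyck (length (A ++ N ∷ [])) (A0 π))
  ρ≡ : ρ π ≡ raise X
  ρ≡ = ρ'-firstBlock-[] _ (suc N) (A ++ N ∷ []) (prefix2k≡[]⇒firstBlock≡[] π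
         (breakAt-head-≡ _ (suc N) (A ++ N ∷ []) (cong suc (sym (lastOr-∷ʳ (suc N ∷ A) N)))))

ρ-firstBlockIsB-¬primitive : ∀ π i → FirstBlockIsB π i → ¬ Primitive (ρ π)
ρ-firstBlockIsB-¬primitive (x ∷ xs) i isB with firstBlockView (x ∷ xs)
... | inj₁ e = contradiction (trans (sym isB) (cong length (prefix2k≡[]⇒slots≡[] (x ∷ xs) e))) (λ ())
... | inj₂ V = decomposable⇒¬primitive _
  (ρ'-firstBlock-large-decomposable (length xs) x xs y r ℕP.≤-refl firstBlock≡ (firstBlockIsB⇒large V i isB))
  where open FirstBlockView V

module FirstBlockSmall (n : ℕ) (x : ℕ) (xs : List ℕ) (π∈D : InD1 (suc n) (x ∷ xs))
  (V : FirstBlockView (x ∷ xs)) (y-small : isLarge (x ∷ xs) (FirstBlockView.y V) ≡ false) where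

  open FirstBlockView V

  π = x ∷ xs
  N = 2 * suc n
  f = length xs
  x₀ = lastOr π
  v = suc x₀
  w = drop (length (y ∷ r)) π
  P₁ = ρ' f (τ (y ∷ r))
  P₂ = ρ' f (τ w)

  ρ≡⊔ : ρ π ≡ P₁ ⊔ P₂
  ρ≡⊔ = ρ'-firstBlock-small f x xs y r firstBlock≡ y-small

  π-length : length π ≡ N
  π-length = proj₁ π∈D

  π-perm : IsPerm π
  π-perm = proj₁ (proj₂ π∈D)

  π-dumont : Dumont1 π
  π-dumont = proj₁ (proj₂ (proj₂ π∈D))

  π-avoids-3142 : Avoids π (3 ∷ 1 ∷ 4 ∷ 2 ∷ [])
  π-avoids-3142 = proj₂ (proj₂ (proj₂ (proj₂ π∈D)))

  π-unique : Unique π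
  π-unique = perm-unique π π-perm

  x₀<N : x₀ < N
  x₀<N = ℕP.≤∧≢⇒< (subst (x₀ ≤_) π-length (proj₂ (perm-∈-bounds π π-perm (lastOr-∈ x xs))))
    (λ e → contradiction (trans (sym (isEven-2* (suc n))) (trans (cong isEven (sym e)) x₀-odd)) (λ ()))
    where
    x₀-odd : isEven x₀ ≡ false
    x₀-odd = dumont1-last-odd x xs π-dumont

  R = proj₂ (breakAt v π)

  π≡ : π ≡ (y ∷ r) ++ s ++ v ∷ R
  π≡ = trans (breakAt-∈ v π (perm-∋ π π-perm x₀ (subst (x₀ <_) (sym π-length) x₀<N)))
         (trans (cong (_++ v ∷ R) prefix≡) (ListP.++-assoc (y ∷ r) s (v ∷ R)))

  w≡ : w ≡ s ++ v ∷ R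
  w≡ = trans (cong (drop (length (y ∷ r))) π≡) (drop-length-++ (y ∷ r) (s ++ v ∷ R))

  w-unique : Unique w
  w-unique = UniqueP.drop⁺ (length (y ∷ r)) π-unique

  w-fits : length w ≤ f
  w-fits = subst (_≤ f) (sym (ListP.length-drop (length (y ∷ r)) π)) (ℕP.m∸n≤m f (length r))

  last-vR : lastOr (v ∷ R) ≡ x₀
  last-vR = sym (trans (cong lastOr (trans π≡ (sym (ListP.++-assoc (y ∷ r) s (v ∷ R)))))
                       (lastOr-++ ((y ∷ r) ++ s) v R))

  d₁ : IsDyck P₁
  d₁ = ρ'-isDyck f (τ (y ∷ r))

  P₁≢[] : P₁ ≢ []
  P₁≢[] = ρ'-nonempty f (τ (y ∷ r)) (λ ()) (subst (_≤ f) (sym (length-τ (y ∷ r)))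
    (ℕP.≤-pred (length-++-< π (y ∷ r) (s ++ v ∷ R) π≡ (λ e → contradiction (ListP.++-conicalʳ s _ e) (λ ())))))

  ρ-primitive : Primitive (ρ π)
  ρ-primitive = subst Primitive (sym ρ≡⊔) (⊔-primitive P₁ P₂ d₁ (ρ'-isDyck f (τ w)))

  markedAt₁-pos : 1 ≤ markedAt 1 (ρ π)
  markedAt₁-pos = subst (λ P → 1 ≤ markedAt 1 P) (sym ρ≡⊔) (⊔-markedAt₁-pos P₁ P₂ d₁ P₁≢[] (ρ'-isDyck f (τ w)))

  -- With a B-block before 2k, P₂ is not primitive, and ⊔ marks the end of Q_{j−1} as well.
  markedAt₁-≥2 : ∀ b s′ → s ≡ b ∷ s′ → isLarge π b ≢ isLarge π y → 2 ≤ markedAt 1 (ρ π)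
  markedAt₁-≥2 b s′ s≡ b-class = subst (λ P → 2 ≤ markedAt 1 P) (sym ρ≡⊔)
    (⊔-markedAt₁-decomposable P₁ P₂ d₁ P₁≢[] (ρ'-isDyck f (τ w))
      (subst (λ W → Decomposable (ρ' f (τ W))) (sym w≡′)
        (ρ'-τ-large-first-decomposable f b (s′ ++ v ∷ R) x₀ (subst Unique w≡′ w-unique)
          (there (∈P.∈-++⁺ʳ s′ (here refl))) (trans (lastOr-++ (b ∷ s′) v R) last-vR) v<b
          (subst (_≤ f) (cong length w≡′) w-fits))))
    where
    w≡′ : w ≡ b ∷ s′ ++ v ∷ R
    w≡′ = trans w≡ (cong (_++ v ∷ R) s≡)
    b-large : isLarge π b ≡ true
    b-large = trans (BoolP.¬-not b-class) (cong not y-small)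
    b≢v : b ≢ v
    b≢v = All.lookup (breakAt-∉ v π) (subst (b ∈_) (sym (trans prefix≡ (cong ((y ∷ r) ++_) s≡)))
            (∈P.∈-++⁺ʳ (y ∷ r) (here refl)))
    v<b : v < b
    v<b = ℕP.≤∧≢⇒< (<ᵇ≡true⇒< x₀ b b-large) (λ e → b≢v (sym e))

  markedAt₁-≡1 : s ≡ [] → markedAt 1 (ρ π) ≡ 1
  markedAt₁-≡1 s≡[] = fromRaise (ρ'-τ-from-2k f x₀ R (subst Unique w≡′ w-unique) last-vR
                                  (subst (_≤ f) (cong length w≡′) w-fits))
    where
    w≡′ : w ≡ v ∷ R
    w≡′ = trans w≡ (cong (_++ v ∷ R) s≡[])
    fromRaise : (∃ λ X → ρ' f (τ (v ∷ R)) ≡ raise X × MarkedDyck X) → markedAt 1 (ρ π) ≡ 1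
    fromRaise (X , P₂≡ , dX , zX) =
      trans (cong (markedAt 1) (trans ρ≡⊔ (cong (P₁ ⊔_) (trans (cong (λ W → ρ' f (τ W)) w≡′) P₂≡))))
            (⊔-markedAt₁-primitive P₁ X d₁ P₁≢[] (proj₂ (ρ'-markedDyck f (τ (y ∷ r)))) dX zX)

  N∈π : N ∈ π
  N∈π = perm-∋ π π-perm (N ∸ 1) (subst (N ∸ 1 <_) (sym π-length) (ℕP.n<1+n (N ∸ 1)))

  2k-even : isEven v ≡ true
  2k-even = trans (isEven-suc x₀) (cong not (dumont1-last-odd x xs π-dumont))

  A₁-small : All (λ z → isLarge π z ≡ false) (y ∷ r)
  A₁-small = y-small ∷ All.map (λ e → trans e y-small) sameClass

  π≡-single : s ≡ [] → π ≡ (y ∷ r) ++ v ∷ R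
  π≡-single s≡[] = trans π≡ (cong (λ t → (y ∷ r) ++ t ++ v ∷ R) s≡[])

  2k≡2n : s ≡ [] → v ≡ N
  2k≡2n s≡[] with v ℕP.≟ N
  ... | yes v≡N = v≡N
  ... | no v≢N with ∈P.∈-++⁻ (y ∷ r) (subst (N ∈_) (π≡-single s≡[]) N∈π)
  ...   | inj₁ N∈A₁ = ⊥-elim (<ᵇ≡false⇒≮ x₀ N (All.lookup A₁-small N∈A₁) x₀<N)
  ...   | inj₂ (here N≡v) = ⊥-elim (v≢N (sym N≡v))
  ...   | inj₂ (there N∈R) = ⊥-elim (no-larger-after-2k π (y ∷ r) x₀ R N (π≡-single s≡[]) π-unique
          π-dumont π-avoids-3142 2k-even refl (ℕP.≤∧≢⇒< x₀<N v≢N) N∈R)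

  single-block-shape : s ≡ [] → ∃₂ λ A₁ A₀ → π ≡ A₁ ++ N ∷ A₀ ++ (N ∸ 1) ∷ []
  single-block-shape s≡[] = y ∷ r , dropLast R ,
    subst (λ M → π ≡ (y ∷ r) ++ M ∷ dropLast R ++ (M ∸ 1) ∷ []) (2k≡2n s≡[])
      (≡-around-2k π (y ∷ r) x₀ R (π≡-single s≡[]) refl)

ρ-firstBlockIsA : ∀ n x xs → InD1 (suc n) (x ∷ xs) → ∀ j → FirstBlockIsA (x ∷ xs) (suc j) →
  let π = x ∷ xs ; N = 2 * suc n in
  Primitive (ρ π) × 1 ≤ markedAt 1 (ρ π)
  × (markedAt 1 (ρ π) ≡ 1 → ∃₂ λ A₁ A₀ → π ≡ A₁ ++ N ∷ A₀ ++ (N ∸ 1) ∷ [])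
  × (2 ≤ markedAt 1 (ρ π) → Bblk π j ≢ [])
ρ-firstBlockIsA n x xs π∈D j isA with firstBlockView (x ∷ xs)
... | inj₁ e = contradiction (trans (sym isA) (cong length (prefix2k≡[]⇒slots≡[] (x ∷ xs) e))) (λ ())
... | inj₂ V = ρ-primitive , markedAt₁-pos , exactlyOne , atLeastTwo
  where
  open FirstBlockView V
  open FirstBlockSmall n x xs π∈D V (firstBlockIsA⇒small V (suc j) isA)
  ¬2≤1 : ¬ 2 ≤ 1
  ¬2≤1 (s≤s ())
  exactlyOne : markedAt 1 (ρ π) ≡ 1 → ∃₂ λ A₁ A₀ → π ≡ A₁ ++ N ∷ A₀ ++ (N ∸ 1) ∷ []
  exactlyOne one with nextBlock
  ... | inj₁ s≡[] = single-block-shape s≡[]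
  ... | inj₂ (b , s′ , s≡ , b-class) = ⊥-elim (¬2≤1 (subst (2 ≤_) one (markedAt₁-≥2 b s′ s≡ b-class)))
  atLeastTwo : 2 ≤ markedAt 1 (ρ π) → Bblk π j ≢ []
  atLeastTwo two B≡[] = ¬2≤1 (subst (2 ≤_) (markedAt₁-≡1 (Bblk≡[]⇒single-block V j isA B≡[])) two)

proposition2 : (n : ℕ) → 2 ≤ n → (π : List ℕ) → InD1 n π →
    ((∃ λ A₀ → π ≡ (2 * n) ∷ A₀ ++ (2 * n ∸ 1) ∷ []) →
        Primitive (ρ π) × markedAt 0 (ρ π) ≡ 0 × markedAt 1 (ρ π) ≡ 0)
    × ((i : ℕ) → FirstBlockIsB π i → ¬ Primitive (ρ π))
    × ((i : ℕ) → 1 ≤ i → FirstBlockIsA π i →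
        Primitive (ρ π) × 1 ≤ markedAt 1 (ρ π)
        × (markedAt 1 (ρ π) ≡ 1 →
             ∃₂ λ A₁ A₀ → π ≡ A₁ ++ (2 * n) ∷ A₀ ++ (2 * n ∸ 1) ∷ [])
        × (2 ≤ markedAt 1 (ρ π) → Bblk π (i ∸ 1) ≢ []))
proposition2 (suc (suc m)) (s≤s (s≤s z≤n)) [] (() , _)
proposition2 (suc (suc m)) (s≤s (s≤s z≤n)) (x ∷ xs) π∈D =
  (λ { (A₀ , refl) → ρ-case₁ (2 * suc (suc m) ∸ 1) A₀ }) ,
  ρ-firstBlockIsB-¬primitive (x ∷ xs) ,
  λ { (suc j) _ isA → ρ-firstBlockIsA (suc m) x xs π∈D j isA }
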